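{- Let $S$ be a nonempty set of primes and $(a_n(q))_{n\ge1}$ a sequence in $\mathbb{Z}[q]$. Then $a_{p^rk}(q)\equiv a_{p^{r-1}k}(q^p)\pmod{[p^r]_{q^k}}$ holds for all $p\in S$ and all integers $k,r\ge1$ with $p\nmid k$, if and only if $\sum_{d\mid n}\mu(d)\,a_{nm/d}(q^d)\equiv0\pmod{[n]_{q^m}}$ for all integers $n\ge1$ divisible only by primes from $S$ and all integers $m\ge1$ coprime to $n$.
   Context: $[n]_q=1+q+\cdots+q^{n-1}$ and $[n]_{q^m}$ is this polynomial evaluated at $q^m$; $\mu$ is the Möbius function; congruences are in $\mathbb{Z}[q]$. -}

module Defs where

open import Data.Nat.DivMod using (_/_)
open import Data.Nat as ℕ using (ℕ; zero; suc)
open import Data.Nat.Divisibility using (_∣_; _∣?_)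
open import Data.Nat.Primality using (Prime; prime?)
open import Data.Integer as ℤ using (ℤ; +_)
open import Data.List using (List; []; _∷_; map; filter; upTo; length; replicate; foldr; _++_)
open import Data.Product using (Σ; ∃; _×_)
open import Relation.Binary.PropositionalEquality using (_≡_)
open import Relation.Nullary.Decidable using (_×-dec_; ¬?)

-- Polynomials in ℤ[q], as coefficient lists (constant term first).
-- Equality is coefficientwise (so trailing zeros are irrelevant).

Poly : Set
Poly = List ℤ

coeff : Poly → ℕ → ℤ
coeff []       _       = + 0
coeff (c ∷ cs) zero    = c
coeff (c ∷ cs) (suc i) = coeff cs i

infix 4 _≈ₚ_
_≈ₚ_ : Poly → Poly → Set
f ≈ₚ g = ∀ i → coeff f i ≡ coeff g i

0ₚ : Poly
0ₚ = []

infixl 6 _+ₚ_ _-ₚ_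
infixl 7 _*ₚ_ _·ₚ_

_+ₚ_ : Poly → Poly → Poly
[]       +ₚ g        = g
(c ∷ cs) +ₚ []       = c ∷ cs
(c ∷ cs) +ₚ (d ∷ ds) = (c ℤ.+ d) ∷ (cs +ₚ ds)

_·ₚ_ : ℤ → Poly → Poly
a ·ₚ f = map (a ℤ.*_) f

-ₚ_ : Poly → Poly
-ₚ f = map ℤ.-_ f

_-ₚ_ : Poly → Poly → Poly
f -ₚ g = f +ₚ (-ₚ g)

_*ₚ_ : Poly → Poly → Poly
[]       *ₚ g = []
(c ∷ cs) *ₚ g = (c ·ₚ g) +ₚ (+ 0 ∷ (cs *ₚ g))

qpow : ℕ → Poly
qpow d = replicate d (+ 0) ++ (+ 1 ∷ [])

-- substitution q ↦ q^d :  f(q) ↦ f(q^d)   (Horner scheme)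
subst : ℕ → Poly → Poly
subst d []       = []
subst d (c ∷ cs) = (c ∷ []) +ₚ (qpow d *ₚ subst d cs)

[_]q : ℕ → Poly
[ n ]q = replicate n (+ 1)

[_]q^ : ℕ → ℕ → Poly
[ n ]q^ m = subst m [ n ]q

infix 4 _∣ₚ_
_∣ₚ_ : Poly → Poly → Set
h ∣ₚ f = Σ Poly λ c → f ≈ₚ h *ₚ c

infix 4 _≡_[modₚ_]
_≡_[modₚ_] : Poly → Poly → Poly → Set
f ≡ g [modₚ h ] = h ∣ₚ (f -ₚ g)

sumₚ : List Poly → Poly
sumₚ = foldr _+ₚ_ 0ₚ

-- Möbius function:
--   μ(n) = 0 if n = 0 (unused) or d² ∣ n for some d ≥ 2,
--   μ(n) = (-1)^ω(n) otherwise, ω(n) = number of distinct primes dividing n.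

nSquareDivisors : ℕ → ℕ
nSquareDivisors n =
  length (filter (λ d → (2 ℕ.≤? d) ×-dec ((d ℕ.* d) ∣? n)) (upTo (suc n)))

ω : ℕ → ℕ
ω n = length (filter (λ p → prime? p ×-dec (p ∣? n)) (upTo (suc n)))

μ : ℕ → ℤ
μ zero = + 0
μ (suc n) with nSquareDivisors (suc n)
... | zero  = (ℤ.- (+ 1)) ℤ.^ ω (suc n)
... | suc _ = + 0

-- Σ_{d ∣ n} μ(d) a_{nm/d}(q^d)

mobiusSum : (ℕ → Poly) → ℕ → ℕ → Poly
mobiusSum a n m =
  sumₚ (map (λ i → μ (suc i) ·ₚ subst (suc i) (a ((n ℕ.* m) / suc i)))
            (filter (λ i → suc i ∣? n) (upTo n)))

{-# OPTIONS --safe #-}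
module Submission where

-- Write n = p^(s+1) n′ with p ∤ n′ and P = p^(s+1), and let S(n, m) = Σ_{d∣n} μ(d) a_{nm/d}(q^d). Splitting the
-- divisors of n according to whether p divides them, with μ(pe) = −μ(e) for p ∤ e and μ(pe) = 0 for p ∣ e, gives
--   S(n, m)(q) = S(n′, Pm)(q) − S(n′, p^s m)(q^p) = Σ_{e∣n′} μ(e) (a_{PK}(q^e) − a_{p^s K}(q^{pe})),   K = n′m/e.
-- For n = P (n′ = 1) this is a_{Pm}(q) − a_{p^s m}(q^p), so the congruences for S at prime powers are exactly the
-- prime-power congruences. Conversely, by induction on n, [n′]_{q^{Pm}} divides both terms of the first form, and the
-- prime-power congruences make [P]_{q^{n′m}} divide every summand of the second. Now
-- [n]_{q^m} = [P]_{q^m} [n′]_{q^{Pm}} = [n′]_{q^m} [P]_{q^{n′m}}, and [P]_q, [n′]_q are comaximal in ℤ[q]: a Bézout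
-- identity x P = 1 + y n′ gives [P]_q [x]_{q^P} − q [n′]_q [y]_{q^{n′}} = 1. Hence [n]_{q^m} divides S(n, m).

open import Algebra.Bundles using (CommutativeMonoid; CommutativeRing)
open import Data.Product using (∃; ∃₂; _,_; _×_)
open import Level using (0ℓ; _⊔_)

-- Placed before the imports below, whose ℕ._*_ would clash with the ring multiplication.
module CommutativeRingDivisibility {c ℓ} (R : CommutativeRing c ℓ) where

  open CommutativeRing R
  open import Algebra.Properties.CommutativeSemigroup *-commutativeSemigroup using (interchange)
  open import Algebra.Properties.Ring ring using (-‿distribˡ-*)
  open import Algebra.Properties.Semiring.Divisibility semiring using (_∣ʳ_; _,_)
  open import Relation.Binary.Reasoning.Setoid setoid

  Comaximal : Carrier → Carrier → Set (c ⊔ ℓ)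
  Comaximal x y = ∃₂ λ u v → u * x + v * y ≈ 1#

  comaximal-sym : ∀ {x y} → Comaximal x y → Comaximal y x
  comaximal-sym (u , v , eq) = v , u , trans (+-comm (v * _) (u * _)) eq

  ∣ʳ-+ : ∀ {x y z} → x ∣ʳ y → x ∣ʳ z → x ∣ʳ y + z
  ∣ʳ-+ {x} (g , gx≈y) (h , hx≈z) = g + h , trans (distribʳ x g h) (+-cong gx≈y hx≈z)

  ∣ʳ-neg : ∀ {x y} → x ∣ʳ y → x ∣ʳ - y
  ∣ʳ-neg {x} (g , gx≈y) = - g , trans (sym (-‿distribˡ-* g x)) (-‿cong gx≈y)

  ∣ʳ-- : ∀ {x y z} → x ∣ʳ y → x ∣ʳ z → x ∣ʳ y - z
  ∣ʳ-- x∣y x∣z = ∣ʳ-+ x∣y (∣ʳ-neg x∣z)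

  comaximal-cofactors⇒∣ʳ : ∀ {x y a b n d} → Comaximal x y → x * a ≈ n → y * b ≈ n →
                           a ∣ʳ d → b ∣ʳ d → n ∣ʳ d
  comaximal-cofactors⇒∣ʳ {x} {y} {a} {b} {n} {d} (u , v , ux+vy≈1) xa≈n yb≈n (g , ga≈d) (h , hb≈d) =
    u * g + v * h , (begin
      (u * g + v * h) * n        ≈⟨ distribʳ n (u * g) (v * h) ⟩
      u * g * n + v * h * n      ≈⟨ +-cong (cross u xa≈n ga≈d) (cross v yb≈n hb≈d) ⟩
      u * x * d + v * y * d      ≈⟨ distribʳ d (u * x) (v * y) ⟨
      (u * x + v * y) * d        ≈⟨ *-congʳ ux+vy≈1 ⟩
      1# * d                     ≈⟨ *-identityˡ d ⟩
      d                          ∎)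
    where
    cross : ∀ w {x a g} → x * a ≈ n → g * a ≈ d → w * g * n ≈ w * x * d
    cross w {x} {a} {g} xa≈n ga≈d = begin
      w * g * n                  ≈⟨ *-congˡ xa≈n ⟨
      (w * g) * (x * a)          ≈⟨ interchange w g x a ⟩
      (w * x) * (g * a)          ≈⟨ *-congˡ ga≈d ⟩
      w * x * d                  ∎

open import Data.Empty using (⊥-elim)
open import Data.Integer as ℤ using (ℤ; +_)
import Data.Integer.Properties as ℤ
open import Data.List using ([]; _∷_; _++_; map; filter; upTo; length)
import Data.List.Properties as List
open import Data.List.Relation.Unary.All using (_∷_)
import Data.List.Relation.Unary.All.Properties as All
import Data.List.Relation.Unary.Any.Properties as Any
open import Data.Maybe as Maybe using (Maybe; just; nothing)
open import Data.Nat using (ℕ; _*_; _^_; _∸_; _≥_)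
open import Data.Nat as ℕ using (zero; suc; NonZero)
open import Data.Nat.Coprimality using (Coprime; coprime-Bézout; coprime-divisor)
import Data.Nat.Coprimality as Coprime
open import Data.Nat.DivMod using (_/_; m*n/m*o≡n/o; m*n/n≡m)
open import Data.Nat.Divisibility
  using (_∣_; _∣?_; divides; m∣m*n; ∣m⇒∣m*n; ∣n⇒∣m*n; ∣-trans; ∣1⇒≡1; ∣⇒≤; >⇒∤; *-monoʳ-∣; *-pres-∣; *-cancelˡ-∣)
open import Data.Nat.GCD using (module Bézout)
open import Data.Nat.Induction using (<-wellFounded)
open import Data.Nat.ListAction using (product)
open import Data.Nat.Primality
  using (Prime; prime?; prime⇒irreducible; prime⇒nonZero; prime⇒nonTrivial; euclidsLemma; ¬prime[1])
open import Data.Nat.Primality.Factorisation using (factorise)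
import Data.Nat.Properties as ℕ
open import Data.Nat.Tactic.RingSolver using (solve-∀)
open import Data.Sum using (inj₁; inj₂; [_,_]′)
open import Defs
open import Function.Base using (id; _∘_; _$_)
open import Function.Bundles using (_⇔_; Equivalence; mk⇔)
open import Induction.WellFounded using (Acc; acc)
open import Relation.Binary.Bundles using (Setoid)
open import Relation.Binary.PropositionalEquality as ≡ using (_≡_; _≢_; refl; cong; cong₂)
open import Relation.Nullary using (¬_; Dec; yes; no; ¬?)
open import Relation.Nullary.Decidable using (_×-dec_)
open import Relation.Unary using (Decidable)
import Tactic.RingSolver as RingSolver
import Tactic.RingSolver.Core.AlmostCommutativeRing as AlmostCommutativeRing

prime⇒≥2 : ∀ {p} → Prime p → 2 ℕ.≤ p
prime⇒≥2 {p} pp = ℕ.nonTrivial⇒n>1 p {{prime⇒nonTrivial pp}}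

prime∤⇒coprime : ∀ {p n} → Prime p → ¬ p ∣ n → Coprime p n
prime∤⇒coprime pp p∤n (d∣p , d∣n) with prime⇒irreducible pp d∣p
... | inj₁ d≡1 = d≡1
... | inj₂ refl = ⊥-elim (p∤n d∣n)

∣p^k*n⇒∣n : ∀ {p d} → Prime p → ¬ p ∣ d → ∀ k {n} → d ∣ p ^ k * n → d ∣ n
∣p^k*n⇒∣n {d = d} pp p∤d zero {n} d∣n = ≡.subst (d ∣_) (ℕ.*-identityˡ n) d∣n
∣p^k*n⇒∣n {p} {d} pp p∤d (suc k) {n} d∣pp^kn = ∣p^k*n⇒∣n pp p∤d k
  (coprime-divisor (Coprime.sym (prime∤⇒coprime pp p∤d)) (≡.subst (d ∣_) (ℕ.*-assoc p (p ^ k) n) d∣pp^kn))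

∣p^k*n⇔∣n : ∀ {p d} → Prime p → ¬ p ∣ d → ∀ k {n} → d ∣ p ^ k * n ⇔ d ∣ n
∣p^k*n⇔∣n {p} pp p∤d k = mk⇔ (∣p^k*n⇒∣n pp p∤d k) (∣n⇒∣m*n (p ^ k))

p*e∣p^[1+s]*n⇔e∣n : ∀ {p e} → Prime p → ¬ p ∣ e → ∀ s {n} → p * e ∣ p ^ suc s * n ⇔ e ∣ n
p*e∣p^[1+s]*n⇔e∣n {p} {e} pp p∤e s {n} = mk⇔
  (λ pe∣Pn → ∣p^k*n⇒∣n pp p∤e s (*-cancelˡ-∣ p {{prime⇒nonZero pp}} (≡.subst (p * e ∣_) (ℕ.*-assoc p (p ^ s) n) pe∣Pn)))
  (λ e∣n → ≡.subst (p * e ∣_) (≡.sym (ℕ.*-assoc p (p ^ s) n)) (*-monoʳ-∣ p (∣n⇒∣m*n (p ^ s) e∣n)))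

prime^-coprime : ∀ {p n} → Prime p → ¬ p ∣ n → ∀ k → Coprime (p ^ k) n
prime^-coprime {p} pp p∤n k {d} (d∣p^k , d∣n) with p ∣? d
... | yes p∣d = ⊥-elim (p∤n (∣-trans p∣d d∣n))
... | no p∤d  = ∣1⇒≡1 (∣p^k*n⇒∣n pp p∤d k (≡.subst (d ∣_) (≡.sym (ℕ.*-identityʳ (p ^ k))) d∣p^k))

prime∣p^k⇒≡ : ∀ {p q} → Prime p → Prime q → ∀ k → q ∣ p ^ k → q ≡ p
prime∣p^k⇒≡ pp pq zero q∣1 = ⊥-elim (¬prime[1] (≡.subst Prime (∣1⇒≡1 q∣1) pq))
prime∣p^k⇒≡ {p} pp pq (suc k) q∣p^[1+k] with euclidsLemma p (p ^ k) pq q∣p^[1+k]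
... | inj₂ q∣p^k = prime∣p^k⇒≡ pp pq k q∣p^k
... | inj₁ q∣p with prime⇒irreducible pp q∣p
...   | inj₁ refl = ⊥-elim (¬prime[1] pq)
...   | inj₂ q≡p  = q≡p

primeFactor : ∀ n → 2 ℕ.≤ n → ∃ λ p → Prime p × p ∣ n
primeFactor n@(suc _) 2≤n with factorise n
... | record { factors = [] ; isFactorisation = n≡1 } = ⊥-elim (ℕ.<-irrefl (≡.sym n≡1) 2≤n)
... | record { factors = p ∷ ps ; isFactorisation = n≡pps ; factorsPrime = pp ∷ _ } =
  p , pp , ≡.subst (p ∣_) (≡.sym n≡pps) (m∣m*n (product ps))

p-adic : ∀ {p} → Prime p → ∀ n → .{{NonZero n}} → ∃₂ λ k n′ → n ≡ p ^ k * n′ × ¬ p ∣ n′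
p-adic {p} pp n = go n (<-wellFounded n)
  where
  go : ∀ n → .{{NonZero n}} → Acc ℕ._<_ n → ∃₂ λ k n′ → n ≡ p ^ k * n′ × ¬ p ∣ n′
  go n (acc rec) with p ∣? n
  ... | no p∤n = 0 , n , ≡.sym (ℕ.*-identityˡ n) , p∤n
  ... | yes (divides q n≡qp) = extend (go q {{q≢0}} (rec q<n))
    where
    q≢0 : NonZero q
    q≢0 = ℕ.≢-nonZero λ { refl → ℕ.≢-nonZero⁻¹ n n≡qp }
    q<n : q ℕ.< n
    q<n = ≡.subst (q ℕ.<_) (≡.sym n≡qp) (ℕ.m<m*n q p {{q≢0}} (prime⇒≥2 pp))
    extend : ∃₂ (λ k n′ → q ≡ p ^ k * n′ × ¬ p ∣ n′) → ∃₂ λ k n′ → n ≡ p ^ k * n′ × ¬ p ∣ n′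
    extend (k , n′ , q≡p^kn′ , p∤n′) =
      suc k , n′ , ≡.trans n≡qp (≡.trans (cong (_* p) q≡p^kn′) (rearrange p (p ^ k) n′)) , p∤n′
      where
      rearrange : ∀ x y z → y * z * x ≡ x * y * z
      rearrange = solve-∀

∤-between-multiples : ∀ {p x d} → p ∣ x → x ℕ.< d → d ℕ.< x ℕ.+ p → ¬ p ∣ d
∤-between-multiples {p} (divides a refl) ap<bp bp<ap+p (divides b refl) =
  ℕ.<⇒≱ (ℕ.*-cancelʳ-< p b (suc a) (≡.subst (b * p ℕ.<_) (ℕ.+-comm (a * p) p) bp<ap+p))
        (ℕ.*-cancelʳ-< p a b ap<bp)

-- Total division: mobiusSum's (n * m) / suc i is (n * m) ⊘ d at d = suc i.
_⊘_ : ℕ → ℕ → ℕ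
m ⊘ zero  = 0
m ⊘ suc n = m / suc n

*⊘-cancelˡ : ∀ k x e → .{{NonZero k}} → .{{NonZero e}} → (k * x) ⊘ (k * e) ≡ x ⊘ e
*⊘-cancelˡ k@(suc _) x e@(suc _) = m*n/m*o≡n/o k x e

*⊘-cancelʳ : ∀ x e → .{{NonZero e}} → (x * e) ⊘ e ≡ x
*⊘-cancelʳ x e@(suc _) = m*n/n≡m x e

⊘-quotient : ∀ {n t e} → .{{NonZero e}} → n ≡ t * e → n ⊘ e ≡ t
⊘-quotient {t = t} {e} n≡te = ≡.trans (cong (_⊘ e) n≡te) (*⊘-cancelʳ t e)

-- The Möbius function

χ : ∀ {A : Set} → Dec A → ℕ
χ (yes _) = 1
χ (no _)  = 0

χ-yes : ∀ {A : Set} (a? : Dec A) → A → χ a? ≡ 1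
χ-yes (yes _) _ = refl
χ-yes (no ¬a) a = ⊥-elim (¬a a)

χ-no : ∀ {A : Set} (a? : Dec A) → ¬ A → χ a? ≡ 0
χ-no (yes a) ¬a = ⊥-elim (¬a a)
χ-no (no _)  _  = refl

χ-⇔ : ∀ {A B : Set} (a? : Dec A) (b? : Dec B) → A ⇔ B → χ a? ≡ χ b?
χ-⇔ (yes _) (yes _) _   = refl
χ-⇔ (no _)  (no _)  _   = refl
χ-⇔ (yes a) (no ¬b) A⇔B = ⊥-elim (¬b (Equivalence.to A⇔B a))
χ-⇔ (no ¬a) (yes b) A⇔B = ⊥-elim (¬a (Equivalence.from A⇔B b))

count : ∀ {P : ℕ → Set} → Decidable P → ℕ → ℕ
count P? K = length (filter P? (upTo K))

module _ {P : ℕ → Set} (P? : Decidable P) where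

  count≡0⇒∄ : ∀ {K x} → count P? K ≡ 0 → x ℕ.< K → ¬ P x
  count≡0⇒∄ count≡0 x<K Px = ℕ.<⇒≢ (List.filter-some P? (Any.applyUpTo⁺ id Px x<K)) (≡.sym count≡0)

  ∄⇒count≡0 : ∀ {K} → (∀ {x} → x ℕ.< K → ¬ P x) → count P? K ≡ 0
  ∄⇒count≡0 {K} ∄ = cong length (List.filter-none P? (All.applyUpTo⁺₁ id K ∄))

  count-suc : ∀ K → count P? (suc K) ≡ count P? K ℕ.+ χ (P? K)
  count-suc K = ≡.trans (cong (λ xs → length (filter P? xs)) (≡.sym (List.upTo-∷ʳ K)))
    (≡.trans (cong length (List.filter-++ P? (upTo K) (K ∷ [])))
      (≡.trans (List.length-++ (filter P? (upTo K))) (cong (count P? K ℕ.+_) last)))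
    where
    last : length (filter P? (K ∷ [])) ≡ χ (P? K)
    last with P? K
    ... | yes _ = refl
    ... | no _  = refl

  count-vanishing : ∀ {K B} → K ℕ.≤ B → (∀ {x} → K ℕ.≤ x → x ℕ.< B → ¬ P x) → count P? B ≡ count P? K
  count-vanishing {K} {zero}  ℕ.z≤n _ = refl
  count-vanishing {K} {suc B} K≤B ¬P with ℕ.m≤n⇒m<n∨m≡n K≤B
  ... | inj₂ refl          = refl
  ... | inj₁ (ℕ.s≤s K≤B′) = begin
    count P? (suc B)         ≡⟨ count-suc B ⟩
    count P? B ℕ.+ χ (P? B)  ≡⟨ cong (count P? B ℕ.+_) (χ-no (P? B) (¬P K≤B′ ℕ.≤-refl)) ⟩
    count P? B ℕ.+ 0         ≡⟨ ℕ.+-identityʳ (count P? B) ⟩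
    count P? B               ≡⟨ count-vanishing K≤B′ (λ K≤x x<B → ¬P K≤x (ℕ.m≤n⇒m≤1+n x<B)) ⟩
    count P? K               ∎
    where open ≡.≡-Reasoning

module _ {P Q : ℕ → Set} (P? : Decidable P) (Q? : Decidable Q) where

  count-agree : ∀ {K} → (∀ {x} → x ℕ.< K → P x ⇔ Q x) → count P? K ≡ count Q? K
  count-agree {zero}  _   = refl
  count-agree {suc K} P⇔Q = ≡.trans (count-suc P? K)
    (≡.trans (cong₂ ℕ._+_ (count-agree (P⇔Q ∘ ℕ.m≤n⇒m≤1+n)) (χ-⇔ (P? K) (Q? K) (P⇔Q ℕ.≤-refl))) (≡.sym (count-suc Q? K)))

  count-insert : ∀ {p} → P p → ¬ Q p → (∀ {x} → x ≢ p → P x ⇔ Q x) →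
                 ∀ {K} → p ℕ.< K → count P? K ≡ suc (count Q? K)
  count-insert {p} Pp ¬Qp P⇔Q {suc K} p<1+K with p ℕ.≟ K
  ... | yes refl = begin
    count P? (suc p)             ≡⟨ count-suc P? p ⟩
    count P? p ℕ.+ χ (P? p)      ≡⟨ cong₂ ℕ._+_ (count-agree (P⇔Q ∘ ℕ.<⇒≢)) (χ-yes (P? p) Pp) ⟩
    count Q? p ℕ.+ 1             ≡⟨ ℕ.+-comm (count Q? p) 1 ⟩
    suc (count Q? p)             ≡⟨ cong suc (ℕ.+-identityʳ (count Q? p)) ⟨
    suc (count Q? p ℕ.+ 0)       ≡⟨ cong (λ c → suc (count Q? p ℕ.+ c)) (χ-no (Q? p) ¬Qp) ⟨
    suc (count Q? p ℕ.+ χ (Q? p)) ≡⟨ cong suc (count-suc Q? p) ⟨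
    suc (count Q? (suc p))        ∎
    where open ≡.≡-Reasoning
  ... | no p≢K = ≡.trans (count-suc P? K)
    (≡.trans (cong₂ ℕ._+_ (count-insert Pp ¬Qp P⇔Q (ℕ.≤∧≢⇒< (ℕ.≤-pred p<1+K) p≢K)) (χ-⇔ (P? K) (Q? K) (P⇔Q (p≢K ∘ ≡.sym))))
      (cong suc (≡.sym (count-suc Q? K))))

-- By definition, nSquareDivisors n = count (squareDivisor? n) (suc n) and ω n = count (primeDivisor? n) (suc n).
SquareDivisor : ℕ → ℕ → Set
SquareDivisor n d = 2 ℕ.≤ d × d * d ∣ n

squareDivisor? : ∀ n → Decidable (SquareDivisor n)
squareDivisor? n d = (2 ℕ.≤? d) ×-dec (d * d ∣? n)

PrimeDivisor : ℕ → ℕ → Set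
PrimeDivisor n p = Prime p × p ∣ n

primeDivisor? : ∀ n → Decidable (PrimeDivisor n)
primeDivisor? n p = prime? p ×-dec (p ∣? n)

μ-nonsquarefree : ∀ {n} → .{{NonZero n}} → nSquareDivisors n ≢ 0 → μ n ≡ + 0
μ-nonsquarefree {suc n} nsd≢0 with nSquareDivisors (suc n)
... | zero  = ⊥-elim (nsd≢0 refl)
... | suc _ = refl

μ-squarefree : ∀ {n} → .{{NonZero n}} → nSquareDivisors n ≡ 0 → μ n ≡ (ℤ.- + 1) ℤ.^ ω n
μ-squarefree {suc n} nsd≡0 with nSquareDivisors (suc n)
... | zero = refl

squareDivisor⇒< : ∀ {n d} → .{{NonZero n}} → SquareDivisor n d → d ℕ.< suc n
squareDivisor⇒< {d = d} (2≤d , d²∣n) =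
  ℕ.s≤s (ℕ.≤-trans (ℕ.m≤m*n d d {{ℕ.>-nonZero (ℕ.≤-trans (ℕ.s≤s ℕ.z≤n) 2≤d)}}) (∣⇒≤ d²∣n))

squareDivisor⇒μ≡0 : ∀ {n d} → .{{NonZero n}} → SquareDivisor n d → μ n ≡ + 0
squareDivisor⇒μ≡0 {n} sd = μ-nonsquarefree λ nsd≡0 → count≡0⇒∄ (squareDivisor? n) nsd≡0 (squareDivisor⇒< sd) sd

ω-p* : ∀ {p e} → Prime p → ¬ p ∣ e → .{{NonZero e}} → ω (p * e) ≡ suc (ω e)
ω-p* {p} {e} pp p∤e = ≡.trans
  (count-insert (primeDivisor? (p * e)) (primeDivisor? e) (pp , m∣m*n e) (λ (_ , p∣e) → p∤e p∣e) agree
    (ℕ.s≤s (ℕ.m≤m*n p e)))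
  (cong suc (count-vanishing (primeDivisor? e) (ℕ.s≤s (ℕ.m≤n*m e p {{prime⇒nonZero pp}}))
    λ e<x _ (_ , x∣e) → >⇒∤ e<x x∣e))
  where
  agree : ∀ {x} → x ≢ p → PrimeDivisor (p * e) x ⇔ PrimeDivisor e x
  agree {x} x≢p = mk⇔ to (λ (px , x∣e) → px , ∣n⇒∣m*n p x∣e)
    where
    to : PrimeDivisor (p * e) x → PrimeDivisor e x
    to (px , x∣pe) with euclidsLemma p e px x∣pe
    ... | inj₂ x∣e = px , x∣e
    ... | inj₁ x∣p with prime⇒irreducible pp x∣p
    ...   | inj₁ refl = ⊥-elim (¬prime[1] px)
    ...   | inj₂ x≡p  = ⊥-elim (x≢p x≡p)

μ-p*-∣ : ∀ {p e} → Prime p → p ∣ e → .{{NonZero e}} → μ (p * e) ≡ + 0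
μ-p*-∣ {p} {e} pp p∣e = squareDivisor⇒μ≡0 {{ℕ.m*n≢0 p e {{prime⇒nonZero pp}}}} (prime⇒≥2 pp , *-monoʳ-∣ p p∣e)

squareDivisor-p*⇒ : ∀ {p e d} → Prime p → ¬ p ∣ e → SquareDivisor (p * e) d → SquareDivisor e d
squareDivisor-p*⇒ {p} {e} {d} pp p∤e (2≤d , d²∣pe) with p ∣? d
... | yes p∣d = ⊥-elim (p∤e (*-cancelˡ-∣ p {{prime⇒nonZero pp}} (∣-trans (*-pres-∣ p∣d p∣d) d²∣pe)))
... | no p∤d  = 2≤d , coprime-divisor (Coprime.sym (prime∤⇒coprime pp p∤d²)) d²∣pe
  where
  p∤d² : ¬ p ∣ d * d
  p∤d² p∣d² = [ p∤d , p∤d ]′ (euclidsLemma d d pp p∣d²)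

μ-p*-∤ : ∀ {p e} → Prime p → ¬ p ∣ e → .{{NonZero e}} → μ (p * e) ≡ ℤ.- μ e
μ-p*-∤ {p} {e} pp p∤e with nSquareDivisors e ℕ.≟ 0
... | yes nsd≡0 = ≡.trans (μ-squarefree {p * e} nsd[pe]≡0) (≡.trans (cong ((ℤ.- + 1) ℤ.^_) (ω-p* pp p∤e))
                   (≡.trans (ℤ.-1*i≡-i _) (cong ℤ.-_ (≡.sym (μ-squarefree {e} nsd≡0)))))
  where
  instance _ = ℕ.m*n≢0 p e {{prime⇒nonZero pp}}
  nsd[pe]≡0 : nSquareDivisors (p * e) ≡ 0
  nsd[pe]≡0 = ∄⇒count≡0 (squareDivisor? (p * e)) {suc (p * e)} λ _ sd →
    let sd′ = squareDivisor-p*⇒ pp p∤e sd in count≡0⇒∄ (squareDivisor? e) {suc e} nsd≡0 (squareDivisor⇒< sd′) sd′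
... | no nsd≢0 = ≡.trans (μ-nonsquarefree {p * e} nsd[pe]≢0) (cong ℤ.-_ (≡.sym (μ-nonsquarefree {e} nsd≢0)))
  where
  instance _ = ℕ.m*n≢0 p e {{prime⇒nonZero pp}}
  nsd[pe]≢0 : nSquareDivisors (p * e) ≢ 0
  nsd[pe]≢0 nsd[pe]≡0 = nsd≢0 (∄⇒count≡0 (squareDivisor? e) {suc e} λ _ (2≤x , x²∣e) →
    let sd = 2≤x , ∣n⇒∣m*n p x²∣e in count≡0⇒∄ (squareDivisor? (p * e)) {suc (p * e)} nsd[pe]≡0 (squareDivisor⇒< sd) sd)

-- The ring ℤ[q]

infix 4 _≋_

-- The coefficientwise equality _≈ₚ_, wrapped in a record so that its arguments can be inferred.
record _≋_ (f g : Poly) : Set where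
  constructor mk≋
  field coeff-≡ : f ≈ₚ g
open _≋_

≋-setoid : Setoid 0ℓ 0ℓ
≋-setoid = record
  { Carrier = Poly
  ; _≈_ = _≋_
  ; isEquivalence = record
    { refl  = mk≋ λ _ → refl
    ; sym   = λ (mk≋ e) → mk≋ λ i → ≡.sym (e i)
    ; trans = λ (mk≋ e) (mk≋ e′) → mk≋ λ i → ≡.trans (e i) (e′ i)
    }
  }

open Setoid ≋-setoid using () renaming (refl to ≋-refl; sym to ≋-sym; trans to ≋-trans; reflexive to ≋-reflexive)
open import Relation.Binary.Reasoning.Setoid ≋-setoid

coeff-+ : ∀ f g i → coeff (f +ₚ g) i ≡ coeff f i ℤ.+ coeff g i
coeff-+ []       g        i       = ≡.sym (ℤ.+-identityˡ _)
coeff-+ (c ∷ cs) []       i       = ≡.sym (ℤ.+-identityʳ _)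
coeff-+ (c ∷ cs) (d ∷ ds) zero    = refl
coeff-+ (c ∷ cs) (d ∷ ds) (suc i) = coeff-+ cs ds i

coeff-· : ∀ a f i → coeff (a ·ₚ f) i ≡ a ℤ.* coeff f i
coeff-· a []       i       = ≡.sym (ℤ.*-zeroʳ a)
coeff-· a (c ∷ cs) zero    = refl
coeff-· a (c ∷ cs) (suc i) = coeff-· a cs i

coeff-neg : ∀ f i → coeff (-ₚ f) i ≡ ℤ.- coeff f i
coeff-neg []       i       = refl
coeff-neg (c ∷ cs) zero    = refl
coeff-neg (c ∷ cs) (suc i) = coeff-neg cs i

+-cong : ∀ {f f′ g g′} → f ≋ f′ → g ≋ g′ → f +ₚ g ≋ f′ +ₚ g′
+-cong {f} {f′} {g} {g′} (mk≋ e) (mk≋ e′) =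
  mk≋ λ i → ≡.trans (coeff-+ f g i) (≡.trans (cong₂ ℤ._+_ (e i) (e′ i)) (≡.sym (coeff-+ f′ g′ i)))

+-congˡ : ∀ f {g g′} → g ≋ g′ → f +ₚ g ≋ f +ₚ g′
+-congˡ f = +-cong (≋-refl {f})

+-comm : ∀ f g → f +ₚ g ≡ g +ₚ f
+-comm []       []       = refl
+-comm []       (d ∷ ds) = refl
+-comm (c ∷ cs) []       = refl
+-comm (c ∷ cs) (d ∷ ds) = cong₂ _∷_ (ℤ.+-comm c d) (+-comm cs ds)

+-assoc : ∀ f g h → (f +ₚ g) +ₚ h ≡ f +ₚ (g +ₚ h)
+-assoc []       g        h        = refl
+-assoc (c ∷ cs) []       h        = refl
+-assoc (c ∷ cs) (d ∷ ds) []       = refl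
+-assoc (c ∷ cs) (d ∷ ds) (e ∷ es) = cong₂ _∷_ (ℤ.+-assoc c d e) (+-assoc cs ds es)

+-identityʳ : ∀ f → f +ₚ [] ≡ f
+-identityʳ []       = refl
+-identityʳ (c ∷ cs) = refl

+-commutativeMonoid : CommutativeMonoid 0ℓ 0ℓ
+-commutativeMonoid = record
  { Carrier = Poly
  ; _≈_ = _≡_
  ; _∙_ = _+ₚ_
  ; ε = []
  ; isCommutativeMonoid = record
    { isMonoid = record
      { isSemigroup = record
        { isMagma = record { isEquivalence = ≡.isEquivalence ; ∙-cong = cong₂ _+ₚ_ }
        ; assoc = +-assoc
        }
      ; identity = (λ _ → refl) , +-identityʳ
      }
    ; comm = +-comm
    }
  }

open import Algebra.Properties.CommutativeSemigroup (CommutativeMonoid.commutativeSemigroup +-commutativeMonoid)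
  using () renaming (interchange to +-interchange; x∙yz≈y∙xz to +-left-comm)

-‿cong : ∀ {f g} → f ≋ g → -ₚ f ≋ -ₚ g
-‿cong {f} {g} (mk≋ e) = mk≋ λ i → ≡.trans (coeff-neg f i) (≡.trans (cong ℤ.-_ (e i)) (≡.sym (coeff-neg g i)))

-‿inverseʳ : ∀ f → f -ₚ f ≋ []
-‿inverseʳ f = mk≋ λ i →
  ≡.trans (coeff-+ f (-ₚ f) i) (≡.trans (cong (λ x → coeff f i ℤ.+ x) (coeff-neg f i)) (ℤ.+-inverseʳ (coeff f i)))

·-cong : ∀ a {f g} → f ≋ g → a ·ₚ f ≋ a ·ₚ g
·-cong a {f} {g} (mk≋ e) = mk≋ λ i → ≡.trans (coeff-· a f i) (≡.trans (cong (a ℤ.*_) (e i)) (≡.sym (coeff-· a g i)))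

0·ₚ : ∀ f → + 0 ·ₚ f ≋ []
0·ₚ f = mk≋ (coeff-· (+ 0) f)

1·ₚ : ∀ f → + 1 ·ₚ f ≡ f
1·ₚ []       = refl
1·ₚ (c ∷ cs) = cong₂ _∷_ (ℤ.*-identityˡ c) (1·ₚ cs)

·-distribˡ : ∀ a f g → a ·ₚ (f +ₚ g) ≡ a ·ₚ f +ₚ a ·ₚ g
·-distribˡ a []       g        = refl
·-distribˡ a (c ∷ cs) []       = refl
·-distribˡ a (c ∷ cs) (d ∷ ds) = cong₂ _∷_ (ℤ.*-distribˡ-+ a c d) (·-distribˡ a cs ds)

·-distribʳ : ∀ a b f → (a ℤ.+ b) ·ₚ f ≡ a ·ₚ f +ₚ b ·ₚ f
·-distribʳ a b []       = refl
·-distribʳ a b (c ∷ cs) = cong₂ _∷_ (ℤ.*-distribʳ-+ c a b) (·-distribʳ a b cs)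

·-assoc : ∀ a b f → a ·ₚ (b ·ₚ f) ≡ (a ℤ.* b) ·ₚ f
·-assoc a b []       = refl
·-assoc a b (c ∷ cs) = cong₂ _∷_ (≡.sym (ℤ.*-assoc a b c)) (·-assoc a b cs)

neg-· : ∀ a f → (ℤ.- a) ·ₚ f ≡ -ₚ (a ·ₚ f)
neg-· a []       = refl
neg-· a (c ∷ cs) = cong₂ _∷_ (≡.sym (ℤ.neg-distribˡ-* a c)) (neg-· a cs)

neg-+ : ∀ f g → -ₚ (f +ₚ g) ≡ -ₚ f +ₚ -ₚ g
neg-+ []       g        = refl
neg-+ (c ∷ cs) []       = refl
neg-+ (c ∷ cs) (d ∷ ds) = cong₂ _∷_ (ℤ.neg-distrib-+ c d) (neg-+ cs ds)

·-neg : ∀ a f → a ·ₚ (-ₚ f) ≡ -ₚ (a ·ₚ f)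
·-neg a []       = refl
·-neg a (c ∷ cs) = cong₂ _∷_ (≡.sym (ℤ.neg-distribʳ-* a c)) (·-neg a cs)

-ₚ≡-1·ₚ : ∀ f → -ₚ f ≡ (ℤ.- + 1) ·ₚ f
-ₚ≡-1·ₚ []       = refl
-ₚ≡-1·ₚ (c ∷ cs) = cong₂ _∷_ (≡.sym (ℤ.-1*i≡-i c)) (-ₚ≡-1·ₚ cs)

∷-cong : ∀ {c d cs ds} → c ≡ d → cs ≋ ds → c ∷ cs ≋ d ∷ ds
∷-cong c≡d (mk≋ e) = mk≋ λ { zero → c≡d ; (suc i) → e i }

∷-injective : ∀ {c d cs ds} → c ∷ cs ≋ d ∷ ds → c ≡ d × cs ≋ ds
∷-injective (mk≋ e) = e 0 , mk≋ (λ i → e (suc i))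

0∷[]≋[] : + 0 ∷ [] ≋ []
0∷[]≋[] = mk≋ λ { zero → refl ; (suc i) → refl }

*-zeroʳ : ∀ f → f *ₚ [] ≋ []
*-zeroʳ []       = ≋-refl
*-zeroʳ (c ∷ cs) = ≋-trans (∷-cong refl (*-zeroʳ cs)) 0∷[]≋[]

≋[]⇒*≋[] : ∀ {f} g → f ≋ [] → f *ₚ g ≋ []
≋[]⇒*≋[] {[]}     g _  = ≋-refl
≋[]⇒*≋[] {c ∷ cs} g e  with c≡0 , cs≋[] ← ∷-injective (≋-trans e (≋-sym 0∷[]≋[])) = begin
  c ·ₚ g +ₚ (+ 0 ∷ cs *ₚ g)
    ≈⟨ +-cong (≋-trans (≋-reflexive (cong (_·ₚ g) c≡0)) (0·ₚ g)) (∷-cong refl (≋[]⇒*≋[] g cs≋[])) ⟩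
  [] +ₚ (+ 0 ∷ [])           ≈⟨ 0∷[]≋[] ⟩
  []                         ∎

*-congʳ : ∀ {f f′} g → f ≋ f′ → f *ₚ g ≋ f′ *ₚ g
*-congʳ {[]}     {f′}       g e = ≋-sym (≋[]⇒*≋[] g (≋-sym e))
*-congʳ {c ∷ cs} {[]}       g e = ≋[]⇒*≋[] g e
*-congʳ {c ∷ cs} {c′ ∷ cs′} g e with c≡c′ , cs≋cs′ ← ∷-injective e =
  +-cong (≋-reflexive (cong (_·ₚ g) c≡c′)) (∷-cong refl (*-congʳ g cs≋cs′))

*-∷ʳ : ∀ f d ds → f *ₚ (d ∷ ds) ≋ d ·ₚ f +ₚ (+ 0 ∷ f *ₚ ds)
*-∷ʳ []       d ds = ≋-sym 0∷[]≋[]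
*-∷ʳ (c ∷ cs) d ds = ∷-cong (cong (ℤ._+ + 0) (ℤ.*-comm c d)) (begin
  c ·ₚ ds +ₚ cs *ₚ (d ∷ ds)                        ≈⟨ +-cong ≋-refl (*-∷ʳ cs d ds) ⟩
  c ·ₚ ds +ₚ (d ·ₚ cs +ₚ (+ 0 ∷ cs *ₚ ds))         ≡⟨ +-left-comm (c ·ₚ ds) (d ·ₚ cs) _ ⟩
  d ·ₚ cs +ₚ (c ·ₚ ds +ₚ (+ 0 ∷ cs *ₚ ds))         ∎)

*-comm : ∀ f g → f *ₚ g ≋ g *ₚ f
*-comm []       g = ≋-sym (*-zeroʳ g)
*-comm (c ∷ cs) g = ≋-trans (+-cong ≋-refl (∷-cong refl (*-comm cs g))) (≋-sym (*-∷ʳ g c cs))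

*-distribʳ : ∀ f g h → (f +ₚ g) *ₚ h ≋ f *ₚ h +ₚ g *ₚ h
*-distribʳ []       g        h = ≋-refl
*-distribʳ (c ∷ cs) []       h = ≋-reflexive (≡.sym (+-identityʳ _))
*-distribʳ (c ∷ cs) (d ∷ ds) h = begin
  (c ℤ.+ d) ·ₚ h +ₚ (+ 0 ∷ (cs +ₚ ds) *ₚ h)
    ≈⟨ +-cong (≋-reflexive (·-distribʳ c d h)) (∷-cong refl (*-distribʳ cs ds h)) ⟩
  (c ·ₚ h +ₚ d ·ₚ h) +ₚ ((+ 0 ∷ cs *ₚ h) +ₚ (+ 0 ∷ ds *ₚ h))  ≡⟨ +-interchange (c ·ₚ h) (d ·ₚ h) _ _ ⟩
  (c ·ₚ h +ₚ (+ 0 ∷ cs *ₚ h)) +ₚ (d ·ₚ h +ₚ (+ 0 ∷ ds *ₚ h))  ∎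

·-*ˡ : ∀ a f g → (a ·ₚ f) *ₚ g ≋ a ·ₚ (f *ₚ g)
·-*ˡ a []       g = ≋-refl
·-*ˡ a (c ∷ cs) g = begin
  (a ℤ.* c) ·ₚ g +ₚ (+ 0 ∷ (a ·ₚ cs) *ₚ g)
    ≈⟨ +-cong (≋-reflexive (≡.sym (·-assoc a c g))) (∷-cong (≡.sym (ℤ.*-zeroʳ a)) (·-*ˡ a cs g)) ⟩
  a ·ₚ (c ·ₚ g) +ₚ a ·ₚ (+ 0 ∷ cs *ₚ g)         ≡⟨ ·-distribˡ a (c ·ₚ g) _ ⟨
  a ·ₚ (c ·ₚ g +ₚ (+ 0 ∷ cs *ₚ g))              ∎

·-*ʳ : ∀ a f g → f *ₚ (a ·ₚ g) ≋ a ·ₚ (f *ₚ g)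
·-*ʳ a f g = ≋-trans (*-comm f (a ·ₚ g)) (≋-trans (·-*ˡ a g f) (·-cong a (*-comm g f)))

*-assoc : ∀ f g h → (f *ₚ g) *ₚ h ≋ f *ₚ (g *ₚ h)
*-assoc []       g h = ≋-refl
*-assoc (c ∷ cs) g h = begin
  (c ·ₚ g +ₚ (+ 0 ∷ cs *ₚ g)) *ₚ h                ≈⟨ *-distribʳ (c ·ₚ g) _ h ⟩
  (c ·ₚ g) *ₚ h +ₚ (+ 0 ∷ cs *ₚ g) *ₚ h
    ≈⟨ +-cong (·-*ˡ c g h) (+-cong (0·ₚ h) (∷-cong refl (*-assoc cs g h))) ⟩
  c ·ₚ (g *ₚ h) +ₚ (+ 0 ∷ cs *ₚ (g *ₚ h))          ∎

1ₚ : Poly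
1ₚ = + 1 ∷ []

*-identityˡ : ∀ f → 1ₚ *ₚ f ≋ f
*-identityˡ f = ≋-trans (+-cong (≋-reflexive (1·ₚ f)) 0∷[]≋[]) (≋-reflexive (+-identityʳ f))

[c]*ₚ : ∀ c f → (c ∷ []) *ₚ f ≋ c ·ₚ f
[c]*ₚ c f = ≋-trans (+-cong ≋-refl 0∷[]≋[]) (≋-reflexive (+-identityʳ (c ·ₚ f)))

PolyRing : CommutativeRing 0ℓ 0ℓ
PolyRing = record
  { Carrier = Poly
  ; _≈_ = _≋_
  ; _+_ = _+ₚ_
  ; _*_ = _*ₚ_
  ; -_ = -ₚ_
  ; 0# = []
  ; 1# = 1ₚ
  ; isCommutativeRing = record
    { isRing = record
      { +-isAbelianGroup = record
        { isGroup = record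
          { isMonoid = record
            { isSemigroup = record
              { isMagma = record { isEquivalence = Setoid.isEquivalence ≋-setoid ; ∙-cong = +-cong }
              ; assoc = λ f g h → ≋-reflexive (+-assoc f g h)
              }
            ; identity = (λ _ → ≋-refl) , (λ f → ≋-reflexive (+-identityʳ f))
            }
          ; inverse = (λ f → ≋-trans (≋-reflexive (+-comm (-ₚ f) f)) (-‿inverseʳ f)) , -‿inverseʳ
          ; ⁻¹-cong = -‿cong
          }
        ; comm = λ f g → ≋-reflexive (+-comm f g)
        }
      ; *-cong = λ {f} {f′} {g} {g′} f≋f′ g≋g′ →
          ≋-trans (*-congʳ g f≋f′) (≋-trans (*-comm f′ g) (≋-trans (*-congʳ f′ g≋g′) (*-comm g′ f′)))
      ; *-assoc = *-assoc
      ; *-identity = *-identityˡ , λ f → ≋-trans (*-comm f 1ₚ) (*-identityˡ f)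
      ; distrib = (λ f g h → ≋-trans (*-comm f (g +ₚ h)) (≋-trans (*-distribʳ g h f) (+-cong (*-comm g f) (*-comm h f))))
                , (λ f g h → *-distribʳ g h f)
      }
    ; *-comm = *-comm
    }
  }

≟[] : ∀ f → Maybe ([] ≋ f)
≟[] []             = just ≋-refl
≟[] (+ zero ∷ cs)  = Maybe.map (λ []≋cs → ≋-trans (≋-sym 0∷[]≋[]) (∷-cong refl []≋cs)) (≟[] cs)
≟[] (_ ∷ _)        = nothing

-- The solver cancels terms only when it can recognise their coefficients as zero.
polyACR : AlmostCommutativeRing.AlmostCommutativeRing 0ℓ 0ℓ
polyACR = AlmostCommutativeRing.fromCommutativeRing PolyRing ≟[]

open import Algebra.Properties.Semiring.Divisibility (CommutativeRing.semiring PolyRing)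
  using (_∣ʳ_; _,_; ∣ʳ-respʳ-≈; ∣ʳ-respˡ-≈; ε∣ʳ_; _∣0)
open CommutativeRingDivisibility PolyRing

*-congˡ : ∀ f {g g′} → g ≋ g′ → f *ₚ g ≋ f *ₚ g′
*-congˡ f = CommutativeRing.*-congˡ PolyRing {f}

∣ʳ⇒∣ₚ : ∀ {h f} → h ∣ʳ f → h ∣ₚ f
∣ʳ⇒∣ₚ {h} (c , ch≋f) = c , coeff-≡ (≋-sym (≋-trans (*-comm h c) ch≋f))

∣ₚ⇒∣ʳ : ∀ h f → h ∣ₚ f → h ∣ʳ f
∣ₚ⇒∣ʳ h f (c , f≈hc) = c , ≋-trans (*-comm c h) (≋-sym (mk≋ f≈hc))

·ₚ-∣ʳ : ∀ {h f} a → h ∣ʳ f → h ∣ʳ a ·ₚ f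
·ₚ-∣ʳ {h} a (c , ch≋f) = a ·ₚ c , ≋-trans (·-*ˡ a c h) (·-cong a ch≋f)

∣ʳ⇒≡0[modₚ] : ∀ {h f} → h ∣ʳ f → f ≡ 0ₚ [modₚ h ]
∣ʳ⇒≡0[modₚ] {f = f} h∣f = ∣ʳ⇒∣ₚ (∣ʳ-respʳ-≈ (≋-reflexive (≡.sym (+-identityʳ f))) h∣f)

≡0[modₚ]⇒∣ʳ : ∀ h f → f ≡ 0ₚ [modₚ h ] → h ∣ʳ f
≡0[modₚ]⇒∣ʳ h f f≡0 = ∣ʳ-respʳ-≈ (≋-reflexive (+-identityʳ f)) (∣ₚ⇒∣ʳ h (f -ₚ 0ₚ) f≡0)

-- Substitution q ↦ q^d

qpow-suc-* : ∀ d f → qpow (suc d) *ₚ f ≋ + 0 ∷ qpow d *ₚ f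
qpow-suc-* d f = +-cong (0·ₚ f) ≋-refl

qpow-+ : ∀ a b → qpow a *ₚ qpow b ≋ qpow (a ℕ.+ b)
qpow-+ zero    b = *-identityˡ (qpow b)
qpow-+ (suc a) b = ≋-trans (qpow-suc-* a (qpow b)) (∷-cong refl (qpow-+ a b))

subst-≋[] : ∀ d {f} → f ≋ [] → subst d f ≋ []
subst-≋[] d {[]}     _ = ≋-refl
subst-≋[] d {c ∷ cs} e with c≡0 , cs≋[] ← ∷-injective (≋-trans e (≋-sym 0∷[]≋[])) =
  ≋-trans (+-cong (∷-cong c≡0 ≋-refl) (≋-trans (*-congˡ (qpow d) (subst-≋[] d cs≋[])) (*-zeroʳ (qpow d)))) 0∷[]≋[]

subst-cong : ∀ d {f g} → f ≋ g → subst d f ≋ subst d g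
subst-cong d {[]}     {g}        e = ≋-sym (subst-≋[] d (≋-sym e))
subst-cong d {c ∷ cs} {[]}       e = subst-≋[] d e
subst-cong d {c ∷ cs} {c′ ∷ cs′} e with c≡c′ , cs≋cs′ ← ∷-injective e =
  +-cong (∷-cong c≡c′ ≋-refl) (*-congˡ (qpow d) (subst-cong d cs≋cs′))

subst-+ : ∀ d f g → subst d (f +ₚ g) ≋ subst d f +ₚ subst d g
subst-+ d []       g        = ≋-refl
subst-+ d (c ∷ cs) []       = ≋-reflexive (≡.sym (+-identityʳ _))
subst-+ d (c ∷ cs) (e ∷ es) = begin
  (c ∷ []) +ₚ (e ∷ []) +ₚ qpow d *ₚ subst d (cs +ₚ es)
    ≈⟨ +-cong ≋-refl (*-congˡ (qpow d) (subst-+ d cs es)) ⟩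
  ((c ∷ []) +ₚ (e ∷ [])) +ₚ qpow d *ₚ (subst d cs +ₚ subst d es)
    ≈⟨ +-cong ≋-refl (CommutativeRing.distribˡ PolyRing (qpow d) (subst d cs) (subst d es)) ⟩
  ((c ∷ []) +ₚ (e ∷ [])) +ₚ (qpow d *ₚ subst d cs +ₚ qpow d *ₚ subst d es)
    ≡⟨ +-interchange (c ∷ []) (e ∷ []) (qpow d *ₚ subst d cs) (qpow d *ₚ subst d es) ⟩
  ((c ∷ []) +ₚ qpow d *ₚ subst d cs) +ₚ ((e ∷ []) +ₚ qpow d *ₚ subst d es) ∎

subst-· : ∀ d a f → subst d (a ·ₚ f) ≋ a ·ₚ subst d f
subst-· d a []       = ≋-refl
subst-· d a (c ∷ cs) = begin
  a ·ₚ (c ∷ []) +ₚ qpow d *ₚ subst d (a ·ₚ cs)   ≈⟨ +-cong ≋-refl (*-congˡ (qpow d) (subst-· d a cs)) ⟩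
  a ·ₚ (c ∷ []) +ₚ qpow d *ₚ (a ·ₚ subst d cs)   ≈⟨ +-cong ≋-refl (·-*ʳ a (qpow d) (subst d cs)) ⟩
  a ·ₚ (c ∷ []) +ₚ a ·ₚ (qpow d *ₚ subst d cs)   ≡⟨ ·-distribˡ a (c ∷ []) (qpow d *ₚ subst d cs) ⟨
  a ·ₚ ((c ∷ []) +ₚ qpow d *ₚ subst d cs)        ∎

subst-neg : ∀ d f → subst d (-ₚ f) ≋ -ₚ subst d f
subst-neg d f = begin
  subst d (-ₚ f)                  ≡⟨ cong (subst d) (-ₚ≡-1·ₚ f) ⟩
  subst d ((ℤ.- + 1) ·ₚ f)        ≈⟨ subst-· d (ℤ.- + 1) f ⟩
  (ℤ.- + 1) ·ₚ subst d f          ≡⟨ -ₚ≡-1·ₚ (subst d f) ⟨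
  -ₚ subst d f                    ∎

subst-- : ∀ d f g → subst d (f -ₚ g) ≋ subst d f -ₚ subst d g
subst-- d f g = ≋-trans (subst-+ d f (-ₚ g)) (+-cong ≋-refl (subst-neg d g))

subst-0∷ : ∀ d f → subst d (+ 0 ∷ f) ≋ qpow d *ₚ subst d f
subst-0∷ d f = +-cong 0∷[]≋[] ≋-refl

subst-* : ∀ d f g → subst d (f *ₚ g) ≋ subst d f *ₚ subst d g
subst-* d []       g = ≋-refl
subst-* d (c ∷ cs) g = begin
  subst d (c ·ₚ g +ₚ (+ 0 ∷ cs *ₚ g))                      ≈⟨ subst-+ d (c ·ₚ g) _ ⟩
  subst d (c ·ₚ g) +ₚ subst d (+ 0 ∷ cs *ₚ g)              ≈⟨ +-cong (subst-· d c g) (subst-0∷ d (cs *ₚ g)) ⟩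
  c ·ₚ subst d g +ₚ qpow d *ₚ subst d (cs *ₚ g)
    ≈⟨ +-cong (≋-sym ([c]*ₚ c (subst d g))) (*-congˡ (qpow d) (subst-* d cs g)) ⟩
  (c ∷ []) *ₚ subst d g +ₚ qpow d *ₚ (subst d cs *ₚ subst d g)
    ≈⟨ distrib-factor (c ∷ []) (qpow d) (subst d cs) (subst d g) ⟩
  ((c ∷ []) +ₚ qpow d *ₚ subst d cs) *ₚ subst d g          ∎
  where
  distrib-factor : ∀ c q s g → c *ₚ g +ₚ q *ₚ (s *ₚ g) ≋ (c +ₚ q *ₚ s) *ₚ g
  distrib-factor = RingSolver.solve-∀ polyACR

subst-const : ∀ d c → subst d (c ∷ []) ≋ c ∷ []
subst-const d c = ≋-trans (+-cong ≋-refl (*-zeroʳ (qpow d))) (≋-reflexive (+-identityʳ (c ∷ [])))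

subst-qpow : ∀ d e → subst d (qpow e) ≋ qpow (d * e)
subst-qpow d zero    = ≋-trans (subst-const d (+ 1)) (≋-reflexive (cong qpow (≡.sym (ℕ.*-zeroʳ d))))
subst-qpow d (suc e) = begin
  subst d (+ 0 ∷ qpow e)      ≈⟨ subst-0∷ d (qpow e) ⟩
  qpow d *ₚ subst d (qpow e)  ≈⟨ *-congˡ (qpow d) (subst-qpow d e) ⟩
  qpow d *ₚ qpow (d * e)      ≈⟨ qpow-+ d (d * e) ⟩
  qpow (d ℕ.+ d * e)          ≡⟨ cong qpow (ℕ.*-suc d e) ⟨
  qpow (d * suc e)            ∎

subst-subst : ∀ a b f → subst a (subst b f) ≋ subst (a * b) f
subst-subst a b []       = ≋-refl
subst-subst a b (c ∷ cs) = begin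
  subst a ((c ∷ []) +ₚ qpow b *ₚ subst b cs)                 ≈⟨ subst-+ a (c ∷ []) (qpow b *ₚ subst b cs) ⟩
  subst a (c ∷ []) +ₚ subst a (qpow b *ₚ subst b cs)
    ≈⟨ +-cong (subst-const a c) (subst-* a (qpow b) (subst b cs)) ⟩
  (c ∷ []) +ₚ subst a (qpow b) *ₚ subst a (subst b cs)
    ≈⟨ +-cong ≋-refl (CommutativeRing.*-cong PolyRing (subst-qpow a b) (subst-subst a b cs)) ⟩
  (c ∷ []) +ₚ qpow (a * b) *ₚ subst (a * b) cs               ∎

subst-1 : ∀ f → subst 1 f ≋ f
subst-1 []       = ≋-refl
subst-1 (c ∷ cs) = begin
  (c ∷ []) +ₚ qpow 1 *ₚ subst 1 cs
    ≈⟨ +-congˡ (c ∷ []) (≋-trans (qpow-suc-* 0 (subst 1 cs)) (∷-cong refl (*-identityˡ (subst 1 cs)))) ⟩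
  (c ∷ []) +ₚ (+ 0 ∷ subst 1 cs)      ≈⟨ ∷-cong (ℤ.+-identityʳ c) (subst-1 cs) ⟩
  c ∷ cs                              ∎

subst-comm : ∀ d e f → subst d (subst e f) ≋ subst e (subst d f)
subst-comm d e f = begin
  subst d (subst e f)   ≈⟨ subst-subst d e f ⟩
  subst (d * e) f       ≡⟨ cong (λ k → subst k f) (ℕ.*-comm d e) ⟩
  subst (e * d) f       ≈⟨ subst-subst e d f ⟨
  subst e (subst d f)   ∎

subst-∣ʳ : ∀ d {h f} → h ∣ʳ f → subst d h ∣ʳ subst d f
subst-∣ʳ d {h} {f} (c , ch≋f) = subst d c , ≋-trans (≋-sym (subst-* d c h)) (subst-cong d ch≋f)

subst-comaximal : ∀ d {f g} → Comaximal f g → Comaximal (subst d f) (subst d g)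
subst-comaximal d {f} {g} (u , v , uf+vg≋1) = subst d u , subst d v , (begin
  subst d u *ₚ subst d f +ₚ subst d v *ₚ subst d g   ≈⟨ +-cong (subst-* d u f) (subst-* d v g) ⟨
  subst d (u *ₚ f) +ₚ subst d (v *ₚ g)               ≈⟨ subst-+ d (u *ₚ f) (v *ₚ g) ⟨
  subst d (u *ₚ f +ₚ v *ₚ g)                         ≈⟨ subst-cong d uf+vg≋1 ⟩
  subst d 1ₚ                                         ≈⟨ subst-const d (+ 1) ⟩
  1ₚ                                                 ∎)

-- q-integers

[+]q : ∀ m n → [ m ℕ.+ n ]q ≋ [ m ]q +ₚ qpow m *ₚ [ n ]q
[+]q zero    n = ≋-sym (*-identityˡ [ n ]q)
[+]q (suc m) n = ≋-trans (∷-cong refl ([+]q m n)) (≋-sym (+-congˡ [ suc m ]q (qpow-suc-* m [ n ]q)))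

[suc]q : ∀ n → [ suc n ]q ≋ 1ₚ +ₚ qpow 1 *ₚ [ n ]q
[suc]q = [+]q 1

[*]q : ∀ a b → [ a * b ]q ≋ [ a ]q *ₚ subst a [ b ]q
[*]q a zero    = ≋-trans (≋-reflexive (cong [_]q (ℕ.*-zeroʳ a))) (≋-sym (*-zeroʳ [ a ]q))
[*]q a (suc b) = begin
  [ a * suc b ]q                                           ≡⟨ cong [_]q (ℕ.*-suc a b) ⟩
  [ a ℕ.+ a * b ]q                                         ≈⟨ [+]q a (a * b) ⟩
  [ a ]q +ₚ qpow a *ₚ [ a * b ]q                           ≈⟨ +-congˡ [ a ]q (*-congˡ (qpow a) ([*]q a b)) ⟩
  [ a ]q +ₚ qpow a *ₚ ([ a ]q *ₚ subst a [ b ]q)           ≈⟨ factor [ a ]q (qpow a) (subst a [ b ]q) ⟩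
  [ a ]q *ₚ subst a [ suc b ]q                             ∎
  where
  factor : ∀ x q s → x +ₚ q *ₚ (x *ₚ s) ≋ x *ₚ (1ₚ +ₚ q *ₚ s)
  factor = RingSolver.solve-∀ polyACR

[*]q^ : ∀ a b m → [ a * b ]q^ m ≋ [ a ]q^ m *ₚ [ b ]q^ (a * m)
[*]q^ a b m = begin
  subst m [ a * b ]q                               ≈⟨ subst-cong m ([*]q a b) ⟩
  subst m ([ a ]q *ₚ subst a [ b ]q)               ≈⟨ subst-* m [ a ]q (subst a [ b ]q) ⟩
  subst m [ a ]q *ₚ subst m (subst a [ b ]q)       ≈⟨ *-congˡ (subst m [ a ]q) (subst-subst m a [ b ]q) ⟩
  subst m [ a ]q *ₚ subst (m * a) [ b ]q           ≡⟨ cong (λ k → subst m [ a ]q *ₚ subst k [ b ]q) (ℕ.*-comm m a) ⟩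
  subst m [ a ]q *ₚ subst (a * m) [ b ]q           ∎

bezout⇒comaximal : ∀ {m n} x y → 1 ℕ.+ y * n ≡ x * m → Comaximal [ m ]q [ n ]q
bezout⇒comaximal {m} {n} x y eq = U , -ₚ (qpow 1 *ₚ Y) , (begin
  U *ₚ [ m ]q +ₚ (-ₚ (qpow 1 *ₚ Y)) *ₚ [ n ]q         ≈⟨ rearrange U [ m ]q (qpow 1) Y [ n ]q ⟩
  [ m ]q *ₚ U -ₚ qpow 1 *ₚ ([ n ]q *ₚ Y)             ≈⟨ +-cong mU≋1+qnY ≋-refl ⟩
  1ₚ +ₚ qpow 1 *ₚ ([ n ]q *ₚ Y) -ₚ qpow 1 *ₚ ([ n ]q *ₚ Y) ≈⟨ cancel 1ₚ (qpow 1 *ₚ ([ n ]q *ₚ Y)) ⟩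
  1ₚ                                                  ∎)
  where
  U = subst m [ x ]q
  Y = subst n [ y ]q
  mU≋1+qnY : [ m ]q *ₚ U ≋ 1ₚ +ₚ qpow 1 *ₚ ([ n ]q *ₚ Y)
  mU≋1+qnY = begin
    [ m ]q *ₚ U                          ≈⟨ [*]q m x ⟨
    [ m * x ]q                           ≡⟨ cong [_]q (≡.trans (ℕ.*-comm m x) (≡.sym eq)) ⟩
    [ suc (y * n) ]q                     ≈⟨ [suc]q (y * n) ⟩
    1ₚ +ₚ qpow 1 *ₚ [ y * n ]q           ≡⟨ cong (λ k → 1ₚ +ₚ qpow 1 *ₚ [ k ]q) (ℕ.*-comm y n) ⟩
    1ₚ +ₚ qpow 1 *ₚ [ n * y ]q           ≈⟨ +-congˡ 1ₚ (*-congˡ (qpow 1) ([*]q n y)) ⟩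
    1ₚ +ₚ qpow 1 *ₚ ([ n ]q *ₚ Y)        ∎
  rearrange : ∀ u a q y b → u *ₚ a +ₚ (-ₚ (q *ₚ y)) *ₚ b ≋ a *ₚ u -ₚ q *ₚ (b *ₚ y)
  rearrange = RingSolver.solve-∀ polyACR
  cancel : ∀ one w → one +ₚ w -ₚ w ≋ one
  cancel = RingSolver.solve-∀ polyACR

comaximal-[]q : ∀ {m n} → Coprime m n → Comaximal [ m ]q [ n ]q
comaximal-[]q c with coprime-Bézout c
... | Bézout.+- x y eq = bezout⇒comaximal x y eq
... | Bézout.-+ x y eq = comaximal-sym (bezout⇒comaximal y x eq)

-- Möbius sums

sumTo : ℕ → (ℕ → Poly) → Poly
sumTo zero    g = []
sumTo (suc N) g = sumTo N g +ₚ g (suc N)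

sumTo-cong : ∀ N {g h} → (∀ {d} → 1 ℕ.≤ d → d ℕ.≤ N → g d ≋ h d) → sumTo N g ≋ sumTo N h
sumTo-cong zero    g≋h = ≋-refl
sumTo-cong (suc N) g≋h = +-cong (sumTo-cong N λ 1≤d d≤N → g≋h 1≤d (ℕ.m≤n⇒m≤1+n d≤N)) (g≋h (ℕ.s≤s ℕ.z≤n) ℕ.≤-refl)

sumTo-+ : ∀ N g h → sumTo N (λ d → g d +ₚ h d) ≋ sumTo N g +ₚ sumTo N h
sumTo-+ zero    g h = ≋-refl
sumTo-+ (suc N) g h = ≋-trans (+-cong (sumTo-+ N g h) ≋-refl)
  (≋-reflexive (+-interchange (sumTo N g) (sumTo N h) (g (suc N)) (h (suc N))))

sumTo-neg : ∀ N g → sumTo N (λ d → -ₚ g d) ≋ -ₚ sumTo N g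
sumTo-neg zero    g = ≋-refl
sumTo-neg (suc N) g = ≋-trans (+-cong (sumTo-neg N g) ≋-refl) (≋-reflexive (≡.sym (neg-+ (sumTo N g) (g (suc N)))))

subst-sumTo : ∀ k N g → subst k (sumTo N g) ≋ sumTo N (λ d → subst k (g d))
subst-sumTo k zero    g = ≋-refl
subst-sumTo k (suc N) g = ≋-trans (subst-+ k (sumTo N g) (g (suc N))) (+-cong (subst-sumTo k N g) ≋-refl)

∣ʳ-sumTo : ∀ {x} N g → (∀ {d} → 1 ℕ.≤ d → d ℕ.≤ N → x ∣ʳ g d) → x ∣ʳ sumTo N g
∣ʳ-sumTo {x} zero    g x∣g = x ∣0
∣ʳ-sumTo     (suc N) g x∣g =
  ∣ʳ-+ (∣ʳ-sumTo N g λ 1≤d d≤N → x∣g 1≤d (ℕ.m≤n⇒m≤1+n d≤N)) (x∣g (ℕ.s≤s ℕ.z≤n) ℕ.≤-refl)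

sumTo-vanishing : ∀ {N B g} → N ℕ.≤ B → (∀ {d} → N ℕ.< d → d ℕ.≤ B → g d ≋ []) → sumTo B g ≋ sumTo N g
sumTo-vanishing {N} {zero}  ℕ.z≤n _ = ≋-refl
sumTo-vanishing {N} {suc B} {g} N≤B g≋[] with ℕ.m≤n⇒m<n∨m≡n N≤B
... | inj₂ refl          = ≋-refl
... | inj₁ (ℕ.s≤s N≤B′) = begin
  sumTo B g +ₚ g (suc B)
    ≈⟨ +-cong (sumTo-vanishing N≤B′ λ N<d d≤B → g≋[] N<d (ℕ.m≤n⇒m≤1+n d≤B)) (g≋[] (ℕ.s≤s N≤B′) ℕ.≤-refl) ⟩
  sumTo N g +ₚ []         ≡⟨ +-identityʳ (sumTo N g) ⟩
  sumTo N g               ∎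

sumTo-multiples : ∀ p {{_ : NonZero p}} N {g} → (∀ {d} → ¬ p ∣ d → g d ≋ []) →
                  sumTo (p * N) g ≋ sumTo N (λ e → g (p * e))
sumTo-multiples p zero {g} g≋[] = ≋-reflexive (cong (λ k → sumTo k g) (ℕ.*-zeroʳ p))
sumTo-multiples p@(suc p′) (suc N) {g} g≋[] = begin
  sumTo (p * suc N) g                        ≡⟨ cong (λ k → sumTo k g) p*[1+N]≡1+[pN+p′] ⟩
  sumTo (p * N ℕ.+ p′) g +ₚ g (suc (p * N ℕ.+ p′))
    ≈⟨ +-cong (sumTo-vanishing (ℕ.m≤m+n (p * N) p′) gap≋[]) (≋-reflexive (cong g (≡.sym p*[1+N]≡1+[pN+p′]))) ⟩
  sumTo (p * N) g +ₚ g (p * suc N)           ≈⟨ +-cong (sumTo-multiples p N g≋[]) ≋-refl ⟩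
  sumTo N (λ e → g (p * e)) +ₚ g (p * suc N) ∎
  where
  p*[1+N]≡1+[pN+p′] : p * suc N ≡ suc (p * N ℕ.+ p′)
  p*[1+N]≡1+[pN+p′] = ≡.trans (ℕ.*-suc p N) (≡.trans (ℕ.+-comm p (p * N)) (ℕ.+-suc (p * N) p′))
  gap≋[] : ∀ {d} → p * N ℕ.< d → d ℕ.≤ p * N ℕ.+ p′ → g d ≋ []
  gap≋[] pN<d d≤pN+p′ = g≋[] (∤-between-multiples (m∣m*n N) pN<d
    (ℕ.≤-trans (ℕ.s≤s d≤pN+p′) (ℕ.≤-reflexive (≡.sym (ℕ.+-suc (p * N) p′)))))

when : ∀ {A : Set} → Dec A → Poly → Poly
when (yes _) f = f
when (no _)  f = []

when-yes : ∀ {A : Set} (a? : Dec A) {f} → A → when a? f ≡ f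
when-yes (yes _) _ = refl
when-yes (no ¬a) a = ⊥-elim (¬a a)

when-no : ∀ {A : Set} (a? : Dec A) {f} → ¬ A → when a? f ≡ []
when-no (yes a) ¬a = ⊥-elim (¬a a)
when-no (no _)  _  = refl

when-⇔ : ∀ {A B : Set} (a? : Dec A) (b? : Dec B) {f} → A ⇔ B → when a? f ≡ when b? f
when-⇔ a?      (yes b) A⇔B = when-yes a? (Equivalence.from A⇔B b)
when-⇔ a?      (no ¬b) A⇔B = when-no a? (λ a → ¬b (Equivalence.to A⇔B a))

when-cong : ∀ {A : Set} (a? : Dec A) {f g} → f ≋ g → when a? f ≋ when a? g
when-cong (yes _) f≋g = f≋g
when-cong (no _)  _   = ≋-refl

when-neg : ∀ {A : Set} (a? : Dec A) f → when a? (-ₚ f) ≡ -ₚ when a? f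
when-neg (yes _) f = refl
when-neg (no _)  f = refl

when-[] : ∀ {A : Set} (a? : Dec A) → when a? [] ≡ []
when-[] (yes _) = refl
when-[] (no _)  = refl

when-split : ∀ {A : Set} (a? : Dec A) f → f ≋ when (¬? a?) f +ₚ when a? f
when-split (yes _) f = ≋-refl
when-split (no _)  f = ≋-reflexive (≡.sym (+-identityʳ f))

μSum : ℕ → (ℕ → Poly) → Poly
μSum n ψ = sumTo n (λ d → when (d ∣? n) (μ d ·ₚ ψ d))

sumₚ-++ : ∀ fs gs → sumₚ (fs ++ gs) ≡ sumₚ fs +ₚ sumₚ gs
sumₚ-++ []       gs = refl
sumₚ-++ (f ∷ fs) gs = ≡.trans (cong (f +ₚ_) (sumₚ-++ fs gs)) (≡.sym (+-assoc f (sumₚ fs) (sumₚ gs)))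

sumₚ-filter-upTo : ∀ {P : ℕ → Set} (P? : Decidable P) (φ : ℕ → Poly) K →
                   sumₚ (map (λ i → φ (suc i)) (filter (λ i → P? (suc i)) (upTo K))) ≋ sumTo K (λ d → when (P? d) (φ d))
sumₚ-filter-upTo P? φ zero    = ≋-refl
sumₚ-filter-upTo P? φ (suc K) = begin
  sumₚ (map φ∘suc (filter P?∘suc (upTo (suc K))))
    ≡⟨ cong (λ is → sumₚ (map φ∘suc (filter P?∘suc is))) (List.upTo-∷ʳ K) ⟨
  sumₚ (map φ∘suc (filter P?∘suc (upTo K ++ K ∷ [])))
    ≡⟨ cong (λ is → sumₚ (map φ∘suc is)) (List.filter-++ P?∘suc (upTo K) (K ∷ [])) ⟩
  sumₚ (map φ∘suc (filter P?∘suc (upTo K) ++ filter P?∘suc (K ∷ [])))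
    ≡⟨ cong sumₚ (List.map-++ φ∘suc (filter P?∘suc (upTo K)) _) ⟩
  sumₚ (map φ∘suc (filter P?∘suc (upTo K)) ++ map φ∘suc (filter P?∘suc (K ∷ [])))
    ≡⟨ sumₚ-++ (map φ∘suc (filter P?∘suc (upTo K))) _ ⟩
  sumₚ (map φ∘suc (filter P?∘suc (upTo K))) +ₚ sumₚ (map φ∘suc (filter P?∘suc (K ∷ [])))
    ≈⟨ +-cong (sumₚ-filter-upTo P? φ K) last ⟩
  sumTo (suc K) (λ d → when (P? d) (φ d))                                ∎
  where
  φ∘suc = λ i → φ (suc i)
  P?∘suc = λ i → P? (suc i)
  last : sumₚ (map φ∘suc (filter P?∘suc (K ∷ []))) ≋ when (P? (suc K)) (φ (suc K))
  last with P? (suc K)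
  ... | yes _ = ≋-reflexive (+-identityʳ (φ (suc K)))
  ... | no _  = ≋-refl

mobiusTerm : (ℕ → Poly) → ℕ → ℕ → ℕ → Poly
mobiusTerm a n m d = subst d (a ((n * m) ⊘ d))

mobiusSum≋μSum : ∀ a n m → mobiusSum a n m ≋ μSum n (mobiusTerm a n m)
mobiusSum≋μSum a n m = sumₚ-filter-upTo (_∣? n) (λ d → μ d ·ₚ mobiusTerm a n m d) n

μSum-cong : ∀ n {ψ χ} → (∀ {d} → .{{NonZero d}} → d ∣ n → ψ d ≋ χ d) → μSum n ψ ≋ μSum n χ
μSum-cong n {ψ} {χ} ψ≋χ = sumTo-cong n term
  where
  term : ∀ {d} → 1 ℕ.≤ d → d ℕ.≤ n → when (d ∣? n) (μ d ·ₚ ψ d) ≋ when (d ∣? n) (μ d ·ₚ χ d)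
  term {d} 1≤d _ with d ∣? n
  ... | yes d∣n = ·-cong (μ d) (ψ≋χ {{ℕ.>-nonZero 1≤d}} d∣n)
  ... | no _    = ≋-refl

μSum-- : ∀ n ψ χ → μSum n (λ d → ψ d -ₚ χ d) ≋ μSum n ψ -ₚ μSum n χ
μSum-- n ψ χ = begin
  μSum n (λ d → ψ d -ₚ χ d)                                            ≈⟨ sumTo-cong n (λ {d} _ _ → term d) ⟩
  sumTo n (λ d → when (d ∣? n) (μ d ·ₚ ψ d) -ₚ when (d ∣? n) (μ d ·ₚ χ d)) ≈⟨ sumTo-+ n _ _ ⟩
  μSum n ψ +ₚ sumTo n (λ d → -ₚ when (d ∣? n) (μ d ·ₚ χ d))             ≈⟨ +-congˡ (μSum n ψ) (sumTo-neg n _) ⟩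
  μSum n ψ -ₚ μSum n χ                                                 ∎
  where
  term : ∀ d → when (d ∣? n) (μ d ·ₚ (ψ d -ₚ χ d)) ≋ when (d ∣? n) (μ d ·ₚ ψ d) -ₚ when (d ∣? n) (μ d ·ₚ χ d)
  term d with d ∣? n
  ... | yes _ = ≋-reflexive (≡.trans (·-distribˡ (μ d) (ψ d) (-ₚ χ d)) (cong (μ d ·ₚ ψ d +ₚ_) (·-neg (μ d) (χ d))))
  ... | no _  = ≋-refl

subst-μSum : ∀ k n ψ → subst k (μSum n ψ) ≋ μSum n (λ d → subst k (ψ d))
subst-μSum k n ψ = ≋-trans (subst-sumTo k n _) (sumTo-cong n λ {d} _ _ → term d)
  where
  term : ∀ d → subst k (when (d ∣? n) (μ d ·ₚ ψ d)) ≋ when (d ∣? n) (μ d ·ₚ subst k (ψ d))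
  term d with d ∣? n
  ... | yes _ = subst-· k (μ d) (ψ d)
  ... | no _  = ≋-refl

∣ʳ-μSum : ∀ {x} n ψ → (∀ {d} → .{{NonZero d}} → d ∣ n → x ∣ʳ ψ d) → x ∣ʳ μSum n ψ
∣ʳ-μSum {x} n ψ x∣ψ = ∣ʳ-sumTo n _ term
  where
  term : ∀ {d} → 1 ℕ.≤ d → d ℕ.≤ n → x ∣ʳ when (d ∣? n) (μ d ·ₚ ψ d)
  term {d} 1≤d _ with d ∣? n
  ... | yes d∣n = ·ₚ-∣ʳ (μ d) (x∣ψ {{ℕ.>-nonZero 1≤d}} d∣n)
  ... | no _    = x ∣0

μSum-1 : ∀ ψ → μSum 1 ψ ≋ ψ 1
μSum-1 ψ = ≋-reflexive (1·ₚ (ψ 1))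

μSum-bound : ∀ {n B} → .{{NonZero n}} → n ℕ.≤ B → ∀ (ψ : ℕ → Poly) →
             sumTo B (λ d → when (d ∣? n) (μ d ·ₚ ψ d)) ≋ μSum n ψ
μSum-bound {n} n≤B ψ = sumTo-vanishing n≤B λ {d} n<d _ → ≋-reflexive (when-no (d ∣? n) (>⇒∤ n<d))

μSum-p^k*-coprimePart : ∀ {p n} → Prime p → ¬ p ∣ n → .{{NonZero n}} → ∀ k (ψ : ℕ → Poly) →
  sumTo (p ^ k * n) (λ d → when (¬? (p ∣? d)) (when (d ∣? p ^ k * n) (μ d ·ₚ ψ d))) ≋ μSum n ψ
μSum-p^k*-coprimePart {p} {n} pp p∤n k ψ = begin
  sumTo N (λ d → when (¬? (p ∣? d)) (when (d ∣? N) (μ d ·ₚ ψ d)))   ≈⟨ sumTo-cong N (λ {d} _ _ → ≋-reflexive (term d)) ⟩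
  sumTo N (λ d → when (d ∣? n) (μ d ·ₚ ψ d))
    ≈⟨ μSum-bound (ℕ.m≤n*m n (p ^ k) {{ℕ.m^n≢0 p k {{prime⇒nonZero pp}}}}) ψ ⟩
  μSum n ψ                                                           ∎
  where
  N = p ^ k * n
  term : ∀ d → when (¬? (p ∣? d)) (when (d ∣? N) (μ d ·ₚ ψ d)) ≡ when (d ∣? n) (μ d ·ₚ ψ d)
  term d with p ∣? d
  ... | yes p∣d = ≡.sym (when-no (d ∣? n) λ d∣n → p∤n (∣-trans p∣d d∣n))
  ... | no p∤d  = when-⇔ (d ∣? N) (d ∣? n) (∣p^k*n⇔∣n pp p∤d k)

μ-term-p* : ∀ {p n e f} → Prime p → ¬ p ∣ n → ∀ s → .{{NonZero e}} →
           when (p * e ∣? p ^ suc s * n) (μ (p * e) ·ₚ f) ≋ -ₚ when (e ∣? n) (μ e ·ₚ f)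
μ-term-p* {p} {n} {e} {f} pp p∤n s with p ∣? e
... | yes p∣e = begin
  when (p * e ∣? p ^ suc s * n) (μ (p * e) ·ₚ f)
    ≈⟨ when-cong (p * e ∣? _) (≋-trans (≋-reflexive (cong (_·ₚ f) (μ-p*-∣ pp p∣e))) (0·ₚ f)) ⟩
  when (p * e ∣? p ^ suc s * n) []                 ≡⟨ when-[] (p * e ∣? _) ⟩
  -ₚ []                                            ≡⟨ cong -ₚ_ (when-no (e ∣? n) λ e∣n → p∤n (∣-trans p∣e e∣n)) ⟨
  -ₚ when (e ∣? n) (μ e ·ₚ f)                      ∎
... | no p∤e = begin
  when (p * e ∣? p ^ suc s * n) (μ (p * e) ·ₚ f)   ≡⟨ cong (λ c → when (p * e ∣? _) (c ·ₚ f)) (μ-p*-∤ pp p∤e) ⟩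
  when (p * e ∣? p ^ suc s * n) ((ℤ.- μ e) ·ₚ f)   ≡⟨ cong (when (p * e ∣? _)) (neg-· (μ e) f) ⟩
  when (p * e ∣? p ^ suc s * n) (-ₚ (μ e ·ₚ f))    ≡⟨ when-⇔ (p * e ∣? _) (e ∣? n) (p*e∣p^[1+s]*n⇔e∣n pp p∤e s) ⟩
  when (e ∣? n) (-ₚ (μ e ·ₚ f))                    ≡⟨ when-neg (e ∣? n) (μ e ·ₚ f) ⟩
  -ₚ when (e ∣? n) (μ e ·ₚ f)                      ∎

μSum-p^[1+s]*-multiplePart : ∀ {p n} → Prime p → ¬ p ∣ n → .{{NonZero n}} → ∀ s (ψ : ℕ → Poly) →
  sumTo (p ^ suc s * n) (λ d → when (p ∣? d) (when (d ∣? p ^ suc s * n) (μ d ·ₚ ψ d)))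
    ≋ -ₚ μSum n (λ e → ψ (p * e))
μSum-p^[1+s]*-multiplePart {p} {n} pp p∤n s ψ = begin
  sumTo N (λ d → when (p ∣? d) (t d))
    ≡⟨ cong (λ K → sumTo K (λ d → when (p ∣? d) (t d))) (ℕ.*-assoc p (p ^ s) n) ⟩
  sumTo (p * M) (λ d → when (p ∣? d) (t d))
    ≈⟨ sumTo-multiples p M (λ {d} p∤d → ≋-reflexive (when-no (p ∣? d) p∤d)) ⟩
  sumTo M (λ e → when (p ∣? p * e) (t (p * e)))
    ≈⟨ sumTo-cong M (λ {e} 1≤e _ →
         ≋-trans (≋-reflexive (when-yes (p ∣? p * e) (m∣m*n e))) (μ-term-p* pp p∤n s {{ℕ.>-nonZero 1≤e}})) ⟩
  sumTo M (λ e → -ₚ when (e ∣? n) (μ e ·ₚ ψ (p * e)))          ≈⟨ sumTo-neg M _ ⟩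
  -ₚ sumTo M (λ e → when (e ∣? n) (μ e ·ₚ ψ (p * e)))
    ≈⟨ -‿cong (μSum-bound (ℕ.m≤n*m n (p ^ s) {{ℕ.m^n≢0 p s {{prime⇒nonZero pp}}}}) _) ⟩
  -ₚ μSum n (λ e → ψ (p * e))                                  ∎
  where
  instance _ = prime⇒nonZero pp
  N = p ^ suc s * n
  M = p ^ s * n
  t : ℕ → Poly
  t d = when (d ∣? N) (μ d ·ₚ ψ d)

μSum-p^[1+s]* : ∀ {p n} → Prime p → ¬ p ∣ n → .{{NonZero n}} → ∀ s (ψ : ℕ → Poly) →
                μSum (p ^ suc s * n) ψ ≋ μSum n ψ -ₚ μSum n (λ e → ψ (p * e))
μSum-p^[1+s]* {p} {n} pp p∤n s ψ = begin
  μSum N ψ                                                ≈⟨ sumTo-cong N (λ {d} _ _ → when-split (p ∣? d) (t d)) ⟩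
  sumTo N (λ d → when (¬? (p ∣? d)) (t d) +ₚ when (p ∣? d) (t d))
    ≈⟨ sumTo-+ N (λ d → when (¬? (p ∣? d)) (t d)) (λ d → when (p ∣? d) (t d)) ⟩
  sumTo N (λ d → when (¬? (p ∣? d)) (t d)) +ₚ sumTo N (λ d → when (p ∣? d) (t d))
    ≈⟨ +-cong (μSum-p^k*-coprimePart pp p∤n (suc s) ψ) (μSum-p^[1+s]*-multiplePart pp p∤n s ψ) ⟩
  μSum n ψ -ₚ μSum n (λ e → ψ (p * e))                    ∎
  where
  N = p ^ suc s * n
  t : ℕ → Poly
  t d = when (d ∣? N) (μ d ·ₚ ψ d)

mobiusSum-p^[1+s]* : ∀ a {p n} → Prime p → ¬ p ∣ n → .{{NonZero n}} → ∀ s m →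
  mobiusSum a (p ^ suc s * n) m ≋ mobiusSum a n (p ^ suc s * m) -ₚ subst p (mobiusSum a n (p ^ s * m))
mobiusSum-p^[1+s]* a {p} {n} pp p∤n s m = begin
  mobiusSum a N m                                            ≈⟨ mobiusSum≋μSum a N m ⟩
  μSum N (mobiusTerm a N m)                                  ≈⟨ μSum-p^[1+s]* pp p∤n s (mobiusTerm a N m) ⟩
  μSum n (mobiusTerm a N m) -ₚ μSum n (λ e → mobiusTerm a N m (p * e))
    ≈⟨ +-cong (μSum-cong n λ {d} _ → ≋-reflexive (cong (λ x → subst d (a (x ⊘ d))) Nm≡n[Pm]))
              (-‿cong (μSum-cong n λ {e} _ → ≋-sym (term e))) ⟩
  μSum n (mobiusTerm a n (P * m)) -ₚ μSum n (λ e → subst p (mobiusTerm a n (p ^ s * m) e))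
    ≈⟨ +-cong (≋-sym (mobiusSum≋μSum a n (P * m))) (-‿cong (≋-sym (subst-μSum p n (mobiusTerm a n (p ^ s * m))))) ⟩
  mobiusSum a n (P * m) -ₚ subst p (μSum n (mobiusTerm a n (p ^ s * m)))
    ≈⟨ +-congˡ (mobiusSum a n (P * m)) (-‿cong (subst-cong p (≋-sym (mobiusSum≋μSum a n (p ^ s * m))))) ⟩
  mobiusSum a n (P * m) -ₚ subst p (mobiusSum a n (p ^ s * m)) ∎
  where
  instance _ = prime⇒nonZero pp
  P = p ^ suc s
  N = P * n
  Nm≡n[Pm] : N * m ≡ n * (P * m)
  Nm≡n[Pm] = rearrange P n m
    where
    rearrange : ∀ x y z → x * y * z ≡ y * (x * z)
    rearrange = solve-∀
  Nm≡p[n[p^sm]] : N * m ≡ p * (n * (p ^ s * m))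
  Nm≡p[n[p^sm]] = rearrange p (p ^ s) n m
    where
    rearrange : ∀ x y z w → x * y * z * w ≡ x * (z * (y * w))
    rearrange = solve-∀
  term : ∀ e → .{{NonZero e}} → subst p (mobiusTerm a n (p ^ s * m) e) ≋ mobiusTerm a N m (p * e)
  term e = begin
    subst p (subst e (a ((n * (p ^ s * m)) ⊘ e)))        ≈⟨ subst-subst p e (a ((n * (p ^ s * m)) ⊘ e)) ⟩
    subst (p * e) (a ((n * (p ^ s * m)) ⊘ e))            ≡⟨ cong (λ x → subst (p * e) (a x)) (*⊘-cancelˡ p _ e) ⟨
    subst (p * e) (a ((p * (n * (p ^ s * m))) ⊘ (p * e)))
      ≡⟨ cong (λ x → subst (p * e) (a (x ⊘ (p * e)))) Nm≡p[n[p^sm]] ⟨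
    subst (p * e) (a ((N * m) ⊘ (p * e)))                ∎

mobiusSum-1 : ∀ a m → mobiusSum a 1 m ≋ a m
mobiusSum-1 a m = begin
  mobiusSum a 1 m                  ≈⟨ mobiusSum≋μSum a 1 m ⟩
  μSum 1 (mobiusTerm a 1 m)        ≈⟨ μSum-1 (mobiusTerm a 1 m) ⟩
  subst 1 (a ((1 * m) ⊘ 1))        ≈⟨ subst-1 (a ((1 * m) ⊘ 1)) ⟩
  a ((1 * m) ⊘ 1)                  ≡⟨ cong a (≡.trans (cong (_⊘ 1) (ℕ.*-comm 1 m)) (*⊘-cancelʳ m 1)) ⟩
  a m                              ∎

mobiusSum-p^[1+s]*≋μSum : ∀ a {p n} → Prime p → ¬ p ∣ n → .{{NonZero n}} → ∀ s m →
  mobiusSum a (p ^ suc s * n) m ≋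
    μSum n (λ e → subst e (a (p ^ suc s * (n ⊘ e * m)) -ₚ subst p (a (p ^ s * (n ⊘ e * m)))))
mobiusSum-p^[1+s]*≋μSum a {p} {n} pp p∤n s m = begin
  mobiusSum a (P * n) m                                         ≈⟨ mobiusSum-p^[1+s]* a pp p∤n s m ⟩
  mobiusSum a n (P * m) -ₚ subst p (mobiusSum a n (p ^ s * m))
    ≈⟨ +-cong (mobiusSum≋μSum a n (P * m))
              (-‿cong (≋-trans (subst-cong p (mobiusSum≋μSum a n (p ^ s * m))) (subst-μSum p n (mobiusTerm a n (p ^ s * m))))) ⟩
  μSum n (mobiusTerm a n (P * m)) -ₚ μSum n (λ e → subst p (mobiusTerm a n (p ^ s * m) e))
    ≈⟨ μSum-- n (mobiusTerm a n (P * m)) (λ e → subst p (mobiusTerm a n (p ^ s * m) e)) ⟨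
  μSum n (λ e → mobiusTerm a n (P * m) e -ₚ subst p (mobiusTerm a n (p ^ s * m) e))
    ≈⟨ μSum-cong n term ⟩
  μSum n (λ e → subst e (a (P * (n ⊘ e * m)) -ₚ subst p (a (p ^ s * (n ⊘ e * m))))) ∎
  where
  P = p ^ suc s
  term : ∀ {e} → .{{NonZero e}} → e ∣ n →
         mobiusTerm a n (P * m) e -ₚ subst p (mobiusTerm a n (p ^ s * m) e) ≋
         subst e (a (P * (n ⊘ e * m)) -ₚ subst p (a (p ^ s * (n ⊘ e * m))))
  term {e} (divides t n≡te) = begin
    subst e (a ((n * (P * m)) ⊘ e)) -ₚ subst p (subst e (a ((n * (p ^ s * m)) ⊘ e)))
      ≡⟨ cong₂ (λ x y → subst e (a x) -ₚ subst p (subst e (a y))) (cofactor P) (cofactor (p ^ s)) ⟩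
    subst e (a (P * (n ⊘ e * m))) -ₚ subst p (subst e (a (p ^ s * (n ⊘ e * m))))
      ≈⟨ +-congˡ (subst e (a (P * (n ⊘ e * m)))) (-‿cong (subst-comm p e (a (p ^ s * (n ⊘ e * m))))) ⟩
    subst e (a (P * (n ⊘ e * m))) -ₚ subst e (subst p (a (p ^ s * (n ⊘ e * m))))
      ≈⟨ subst-- e (a (P * (n ⊘ e * m))) (subst p (a (p ^ s * (n ⊘ e * m)))) ⟨
    subst e (a (P * (n ⊘ e * m)) -ₚ subst p (a (p ^ s * (n ⊘ e * m)))) ∎
    where
    cofactor : ∀ x → (n * (x * m)) ⊘ e ≡ x * (n ⊘ e * m)
    cofactor x = ≡.trans (cong (λ k → (k * (x * m)) ⊘ e) n≡te)
      (≡.trans (cong (_⊘ e) (rearrange t e x m))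
        (≡.trans (*⊘-cancelʳ (x * (t * m)) e) (cong (λ k → x * (k * m)) (≡.sym (⊘-quotient {n} {t} n≡te)))))
      where
      rearrange : ∀ t e x m → t * e * (x * m) ≡ x * (t * m) * e
      rearrange = solve-∀

MobiusCongruence : (ℕ → Poly) → ℕ → Set
MobiusCongruence a n = ∀ m → m ≥ 1 → Coprime n m → mobiusSum a n m ≡ 0ₚ [modₚ [ n ]q^ m ]

PrimePowerCongruences : (ℕ → Poly) → ℕ → Set
PrimePowerCongruences a p = ∀ k r → k ≥ 1 → r ≥ 1 → ¬ p ∣ k →
  a (p ^ r * k) ≡ subst p (a (p ^ (r ∸ 1) * k)) [modₚ [ p ^ r ]q^ k ]

[n]q^-∣ʳ-mobiusSum-p^[1+s]* : ∀ a {p n} → Prime p → ¬ p ∣ n → .{{NonZero n}} → ∀ s → MobiusCongruence a n →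
  ∀ m → m ≥ 1 → Coprime (p ^ suc s * n) m → [ n ]q^ (p ^ suc s * m) ∣ʳ mobiusSum a (p ^ suc s * n) m
[n]q^-∣ʳ-mobiusSum-p^[1+s]* a {p} {n} pp p∤n s ih m m≥1 cop =
  ∣ʳ-respʳ-≈ (≋-sym (mobiusSum-p^[1+s]* a pp p∤n s m)) (∣ʳ-- (divides-mobiusSum (suc s)) divides-subst)
  where
  P = p ^ suc s
  coprime : ∀ j → Coprime n (p ^ j * m)
  coprime j {d} (d∣n , d∣p^jm) with p ∣? d
  ... | yes p∣d = ⊥-elim (p∤n (∣-trans p∣d d∣n))
  ... | no p∤d  = cop (∣n⇒∣m*n P d∣n , ∣p^k*n⇒∣n pp p∤d j d∣p^jm)
  divides-mobiusSum : ∀ j → [ n ]q^ (p ^ j * m) ∣ʳ mobiusSum a n (p ^ j * m)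
  divides-mobiusSum j = ≡0[modₚ]⇒∣ʳ _ (mobiusSum a n (p ^ j * m))
    (ih (p ^ j * m) (ℕ.*-mono-≤ (ℕ.m^n>0 p {{prime⇒nonZero pp}} j) m≥1) (coprime j))
  divides-subst : [ n ]q^ (P * m) ∣ʳ subst p (mobiusSum a n (p ^ s * m))
  divides-subst = ∣ʳ-respˡ-≈
    (≋-trans (subst-subst p (p ^ s * m) [ n ]q) (≋-reflexive (cong (λ k → [ n ]q^ k) (≡.sym (ℕ.*-assoc p (p ^ s) m)))))
    (subst-∣ʳ p (divides-mobiusSum s))

[p^[1+s]]q^-∣ʳ-mobiusSum-p^[1+s]* : ∀ a {p n} → Prime p → ¬ p ∣ n → .{{NonZero n}} → ∀ s →
  PrimePowerCongruences a p →
  ∀ m → m ≥ 1 → Coprime (p ^ suc s * n) m → [ p ^ suc s ]q^ (n * m) ∣ʳ mobiusSum a (p ^ suc s * n) m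
[p^[1+s]]q^-∣ʳ-mobiusSum-p^[1+s]* a {p} {n} pp p∤n s congP m m≥1 cop = ∣ʳ-respʳ-≈
  (≋-sym (mobiusSum-p^[1+s]*≋μSum a pp p∤n s m))
  (∣ʳ-μSum n _ term)
  where
  P = p ^ suc s
  term : ∀ {e} → .{{NonZero e}} → e ∣ n →
         [ P ]q^ (n * m) ∣ʳ subst e (a (P * (n ⊘ e * m)) -ₚ subst p (a (p ^ s * (n ⊘ e * m))))
  term {e} (divides t n≡te) =
    ∣ʳ-respˡ-≈ [P]q^eK≋[P]q^nm (subst-∣ʳ e (∣ₚ⇒∣ʳ ([ P ]q^ K) (a (P * K) -ₚ subst p (a (p ^ s * K)))
      (congP K (suc s) K≥1 (ℕ.s≤s ℕ.z≤n) p∤K)))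
    where
    K = n ⊘ e * m
    K≡tm : K ≡ t * m
    K≡tm = cong (_* m) (⊘-quotient {n} {t} n≡te)
    t≢0 : NonZero t
    t≢0 = ℕ.≢-nonZero λ { refl → ℕ.≢-nonZero⁻¹ n n≡te }
    K≥1 : K ≥ 1
    K≥1 = ≡.subst (_≥ 1) (≡.sym K≡tm) (ℕ.*-mono-≤ (ℕ.>-nonZero⁻¹ t {{t≢0}}) m≥1)
    p∤K : ¬ p ∣ K
    p∤K p∣K with euclidsLemma t m pp (≡.subst (p ∣_) K≡tm p∣K)
    ... | inj₁ p∣t = p∤n (≡.subst (p ∣_) (≡.sym n≡te) (∣m⇒∣m*n e p∣t))
    ... | inj₂ p∣m = ¬prime[1] (≡.subst Prime (cop (∣m⇒∣m*n n (m∣m*n (p ^ s)) , p∣m)) pp)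
    [P]q^eK≋[P]q^nm : subst e ([ P ]q^ K) ≋ [ P ]q^ (n * m)
    [P]q^eK≋[P]q^nm = ≋-trans (subst-subst e K [ P ]q) (≋-reflexive (cong (λ k → [ P ]q^ k) eK≡nm))
      where
      eK≡nm : e * K ≡ n * m
      eK≡nm = ≡.trans (cong (e *_) K≡tm) (≡.trans (rearrange e t m) (cong (_* m) (≡.sym n≡te)))
        where
        rearrange : ∀ e t m → e * (t * m) ≡ t * e * m
        rearrange = solve-∀

mobiusCongruence-p^[1+s]* : ∀ a {p n} → Prime p → ¬ p ∣ n → .{{NonZero n}} → ∀ s →
  PrimePowerCongruences a p → MobiusCongruence a n → MobiusCongruence a (p ^ suc s * n)
mobiusCongruence-p^[1+s]* a {p} {n} pp p∤n s congP ih m m≥1 cop = ∣ʳ⇒≡0[modₚ] $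
  comaximal-cofactors⇒∣ʳ
    (subst-comaximal m (comaximal-[]q (prime^-coprime pp p∤n (suc s))))
    (≋-sym ([*]q^ P n m))
    (≋-trans (≋-sym ([*]q^ n P m)) (≋-reflexive (cong (λ k → [ k ]q^ m) (ℕ.*-comm n P))))
    ([n]q^-∣ʳ-mobiusSum-p^[1+s]* a pp p∤n s ih m m≥1 cop)
    ([p^[1+s]]q^-∣ʳ-mobiusSum-p^[1+s]* a pp p∤n s congP m m≥1 cop)
  where
  P = p ^ suc s

mobiusCongruence-1 : ∀ a → MobiusCongruence a 1
mobiusCongruence-1 a m _ _ = ∣ʳ⇒≡0[modₚ] (∣ʳ-respˡ-≈ (≋-sym (subst-const m (+ 1))) (ε∣ʳ mobiusSum a 1 m))

primePowerCongruences⇒mobiusCongruence : ∀ {S : ℕ → Set} a → (∀ p → S p → PrimePowerCongruences a p) →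
  ∀ n → n ≥ 1 → (∀ p → Prime p → p ∣ n → S p) → MobiusCongruence a n
primePowerCongruences⇒mobiusCongruence {S} a congS n n≥1 = go n {{ℕ.>-nonZero n≥1}} (<-wellFounded n)
  where
  go : ∀ n → .{{NonZero n}} → Acc ℕ._<_ n → (∀ p → Prime p → p ∣ n → S p) → MobiusCongruence a n
  go 1                _          _      = mobiusCongruence-1 a
  go n@(suc (suc _)) (acc rec) smooth with p , pp , p∣n ← primeFactor n (ℕ.s≤s (ℕ.s≤s ℕ.z≤n)) with p-adic pp n
  ... | zero  , n′ , n≡n′ , p∤n′ = ⊥-elim (p∤n′ (≡.subst (p ∣_) (≡.trans n≡n′ (ℕ.*-identityˡ n′)) p∣n))
  ... | suc s , n′ , n≡Pn′ , p∤n′ = ≡.subst (MobiusCongruence a) (≡.sym n≡Pn′)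
    (mobiusCongruence-p^[1+s]* a pp p∤n′ {{n′≢0}} s (congS p (smooth p pp p∣n))
      (go n′ {{n′≢0}} (rec n′<n) λ q pq q∣n′ → smooth q pq (≡.subst (q ∣_) (≡.sym n≡Pn′) (∣n⇒∣m*n (p ^ suc s) q∣n′))))
    where
    n′≢0 : NonZero n′
    n′≢0 = ℕ.≢-nonZero λ { refl → ℕ.≢-nonZero⁻¹ n (≡.trans n≡Pn′ (ℕ.*-zeroʳ (p ^ suc s))) }
    n′<n : n′ ℕ.< n
    n′<n = ≡.subst (n′ ℕ.<_) (≡.trans (ℕ.*-comm n′ (p ^ suc s)) (≡.sym n≡Pn′))
             (ℕ.m<m*n n′ (p ^ suc s) {{n′≢0}} (ℕ.*-mono-≤ (prime⇒≥2 pp) (ℕ.m^n>0 p {{prime⇒nonZero pp}} s)))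

mobiusCongruence⇒primePowerCongruences : ∀ a {p} → Prime p → (∀ r → r ≥ 1 → MobiusCongruence a (p ^ r)) →
                                         PrimePowerCongruences a p
mobiusCongruence⇒primePowerCongruences a pp mc k zero    k≥1 () p∤k
mobiusCongruence⇒primePowerCongruences a {p} pp mc k (suc s) k≥1 _  p∤k = ∣ʳ⇒∣ₚ $
  ∣ʳ-respʳ-≈ D≋ (≡0[modₚ]⇒∣ʳ ([ P ]q^ k) (mobiusSum a P k) (mc (suc s) (ℕ.s≤s ℕ.z≤n) k k≥1 (prime^-coprime pp p∤k (suc s))))
  where
  P = p ^ suc s
  D≋ : mobiusSum a P k ≋ a (P * k) -ₚ subst p (a (p ^ s * k))
  D≋ = begin
    mobiusSum a P k                                                ≡⟨ cong (λ N → mobiusSum a N k) (ℕ.*-identityʳ P) ⟨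
    mobiusSum a (P * 1) k
      ≈⟨ mobiusSum-p^[1+s]* a pp (λ p∣1 → ¬prime[1] (≡.subst Prime (∣1⇒≡1 p∣1) pp)) s k ⟩
    mobiusSum a 1 (P * k) -ₚ subst p (mobiusSum a 1 (p ^ s * k))
      ≈⟨ +-cong (mobiusSum-1 a (P * k)) (-‿cong (subst-cong p (mobiusSum-1 a (p ^ s * k)))) ⟩
    a (P * k) -ₚ subst p (a (p ^ s * k))                           ∎

theorem8 : (S : ℕ → Set) → (∀ p → S p → Prime p) → ∃ S →
    (a : ℕ → Poly) →
    ((∀ p → S p → ∀ k r → k ≥ 1 → r ≥ 1 → ¬ (p ∣ k) →
        a (p ^ r * k) ≡ subst p (a (p ^ (r ∸ 1) * k)) [modₚ [ p ^ r ]q^ k ])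
     ⇔
     (∀ n → n ≥ 1 → (∀ p → Prime p → p ∣ n → S p) →
        ∀ m → m ≥ 1 → Coprime n m →
        mobiusSum a n m ≡ 0ₚ [modₚ [ n ]q^ m ]))
theorem8 S S⊆Prime _ a = mk⇔
  (primePowerCongruences⇒mobiusCongruence a)
  (λ mc p Sp → let pp = S⊆Prime p Sp in
    mobiusCongruence⇒primePowerCongruences a pp λ r r≥1 →
      mc (p ^ r) (ℕ.m^n>0 p {{prime⇒nonZero pp}} r) λ q pq q∣p^r → ≡.subst S (≡.sym (prime∣p^k⇒≡ pp pq r q∣p^r)) Sp)
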